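{- Let $1\le a\le b\le c$ be integers with $a<c$, let $K=K_{a,b,c}$ and $k=a+b+c$. Let $K_1$ be a copy of $K$ and $u,u'$ two vertices not in $V(K_1)$. Let $L$ be any $3$-graph on vertex set $\{u,u'\}\cup V(K_1)$ whose edge set contains $E(K_1)$ and at least $a+1$ triples $uu'v$ with $v\in V(K_1)$. Then there is a fractional hom$(K)$-tiling $h$ of $L$ with $w(h)\ge k+\frac1{abc}$ and $h_{\min}\ge\frac1{bc^2}$.
   Context: For a $3$-graph $G=(V,E)$, a fractional hom$(K_{a,b,c})$-tiling is a function $h:V\times E\to[0,1]$ such that (1) $h(v,e)=0$ if $v\notin e$; (2) $\sum_{e\in E}h(v,e)\le1$ for every $v$; (3) every $e\in E$ admits a labeling $e=uvw$ with $h(u,e)\le h(v,e)\le h(w,e)$ and $h(u,e)/a\ge h(v,e)/b\ge h(w,e)/c$. $h_{\min}$ is the smallest nonzero value of $h$, and $w(h)=\sum_{(v,e)\in V\times E}h(v,e)$. $K_{a,b,c}$ is the complete $3$-partite $3$-graph with parts of sizes $a,b,c$. -}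

module Defs where

open import Data.Nat as ℕ using (ℕ; zero; suc; _+_; _*_; _<_; _≤_)
open import Data.Fin as Fin using (Fin; toℕ; _↑ʳ_)
open import Data.Fin.Subset using (Subset; ⁅_⁆; _∪_; ∣_∣; _∈_; _∉_)
open import Data.List using (List; foldr; map; allFin)
open import Data.List.Relation.Unary.All using (All)
open import Data.List.Relation.Unary.Unique.Propositional using (Unique)
import Data.List.Membership.Propositional as LM
open import Data.Integer using (+_)
open import Data.Rational as ℚ using (ℚ; 0ℚ; 1ℚ)
open import Data.Product using (Σ; ∃; _×_; _,_)
open import Relation.Binary.PropositionalEquality using (_≡_; _≢_)

record ThreeGraph (n : ℕ) : Set where
  field
    edges   : List (Subset n)
    size3   : All (λ e → ∣ e ∣ ≡ 3) edges
    nodup   : Unique edges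
open ThreeGraph public

_∈E_ : {n : ℕ} → Subset n → ThreeGraph n → Set
e ∈E G = e LM.∈ edges G

triple : {n : ℕ} → Fin n → Fin n → Fin n → Subset n
triple x y z = ⁅ x ⁆ ∪ (⁅ y ⁆ ∪ ⁅ z ⁆)

sumℚ : List ℚ → ℚ
sumℚ = foldr ℚ._+_ 0ℚ

ℕtoℚ : ℕ → ℚ
ℕtoℚ m = + m ℚ./ 1

-- reciprocal 1/m of a natural number (only used with m ≥ 1; 1/0 := 0)
recip : ℕ → ℚ
recip zero    = 0ℚ
recip (suc m) = + 1 ℚ./ suc m

record IsFracHomTiling (a b c : ℕ) {n : ℕ} (G : ThreeGraph n)
                       (h : Fin n → Subset n → ℚ) : Set where
  field
    range    : ∀ v e → e ∈E G → (0ℚ ℚ.≤ h v e) × (h v e ℚ.≤ 1ℚ)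
    support  : ∀ v e → e ∈E G → v ∉ e → h v e ≡ 0ℚ
    capacity : ∀ v → sumℚ (map (h v) (edges G)) ℚ.≤ 1ℚ
    -- (3) labeling e = uvw with h(u)≤h(v)≤h(w) and h(u)/a ≥ h(v)/b ≥ h(w)/c
    --     (the ratio conditions written multiplied out: b·h(u) ≥ a·h(v), c·h(v) ≥ b·h(w))
    shape    : ∀ e → e ∈E G → Σ (Fin n) λ x → Σ (Fin n) λ y → Σ (Fin n) λ z →
                 (e ≡ triple x y z) ×
                 (h x e ℚ.≤ h y e) × (h y e ℚ.≤ h z e) ×
                 (ℕtoℚ a ℚ.* h y e ℚ.≤ ℕtoℚ b ℚ.* h x e) ×
                 (ℕtoℚ b ℚ.* h z e ℚ.≤ ℕtoℚ c ℚ.* h y e)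

weight : {n : ℕ} → ThreeGraph n → (Fin n → Subset n → ℚ) → ℚ
weight {n} G h = sumℚ (map (λ e → sumℚ (map (λ v → h v e) (allFin n))) (edges G))

hminAtLeast : {n : ℕ} → ThreeGraph n → (Fin n → Subset n → ℚ) → ℚ → Set
hminAtLeast G h q = ∀ v e → e ∈E G → h v e ≢ 0ℚ → q ℚ.≤ h v e

-- Setting of Prop 4.6: vertex set Fin (2 + k), u = 0, u' = 1,
-- V(K₁) = {2, …, k+1}; vertex 2 + i of K₁ lies in part A if i < a,
-- part B if a ≤ i < a + b, part C if a + b ≤ i  (|A|=a, |B|=b, |C|=c).
inK : {k : ℕ} → Fin k → Fin (2 + k)
inK i = 2 Fin.↑ʳ i

u₀ u₁ : {k : ℕ} → Fin (2 + k)
u₀ = Fin.zero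
u₁ = Fin.suc Fin.zero

containsK : (a b c : ℕ) → ThreeGraph (2 + (a + b + c)) → Set
containsK a b c L = ∀ (x y z : Fin (a + b + c)) →
  toℕ x < a → (a ≤ toℕ y × toℕ y < a + b) → a + b ≤ toℕ z →
  triple (inK x) (inK y) (inK z) ∈E L

manyUU' : (a b c : ℕ) → ThreeGraph (2 + (a + b + c)) → Set
manyUU' a b c L = Σ (Subset (a + b + c)) λ S → (suc a ≤ ∣ S ∣) ×
  (∀ v → v ∈ S → triple u₀ u₁ (inK v) ∈E L)

-- All weights of the tiling are natural numbers over the common denominator M = 2a²bc.
-- Giving every edge xyz of K₁ (x ∈ A, y ∈ B, z ∈ C) multiplicity 2, i.e. the weights
-- 2a·(a, b, c), saturates every vertex of K₁ and has total weight M·k.  Since S has at least a + 1 vertices it meets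
-- C, or it meets B and a < b, or a = b and it meets both A and B.  In each case one edge of
-- K₁ loses multiplicity δ (δ = 2, or δ = 1 when a = b), freeing δ times its weights at its
-- three vertices, and one or two triples through u and u' pick up that freed capacity with
-- weights in the shape of K; they carry at least the removed weight δ·a·k plus 2a, and
-- 2a/M = 1/(abc).  Every nonzero weight is at least a², and a²/M ≥ 1/(bc²) as c ≥ 2.

module Submission where

open import Data.Bool using (if_then_else_)
import Data.Bool as Bool
open import Data.Empty using (⊥-elim)
open import Data.Fin as Fin using (Fin; toℕ)
import Data.Fin.Properties as FinP
open import Data.Fin.Properties using (_≟_)
open import Data.Fin.Subset as Subset using (Subset; ⁅_⁆; _∪_; ∣_∣; inside; outside)
  renaming (_∈_ to _∈ₛ_; _∉_ to _∉ₛ_)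
import Data.Fin.Subset.Properties as SubsetP
import Data.Integer as ℤ
import Data.Integer.Properties as ℤP
open import Data.List using (List; []; _∷_; _++_; map; length; concatMap; allFin)
import Data.List.Properties as ListP
open import Data.List.Membership.Propositional using (_∈_; _∉_; find)
import Data.List.Membership.Propositional.Properties as ∈P
open import Data.List.Relation.Unary.All using (All; []; _∷_)
import Data.List.Relation.Unary.All as All
open import Data.List.Relation.Unary.All.Properties using (All¬⇒¬Any; ¬Any⇒All¬)
import Data.List.Relation.Unary.All.Properties as AllP
import Data.List.Relation.Unary.AllPairs as AllPairs
open import Data.List.Relation.Unary.Any using (Any; any?; here; there)
open import Data.List.Relation.Unary.Unique.Propositional using (Unique)
import Data.List.Relation.Unary.Unique.Propositional.Properties as UniqueP
open import Data.Nat as ℕ using (ℕ; zero; suc; _+_; _*_; _∸_; _≤_; _<_; NonZero; pred)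
import Data.Nat.Properties as ℕP
open import Data.Nat.Tactic.RingSolver using (solve-∀)
open import Data.Product using (Σ; _×_; _,_; proj₁; proj₂)
open import Data.Rational as ℚ using (ℚ; 0ℚ; 1ℚ; toℚᵘ)
import Data.Rational.Properties as ℚP
open import Data.Rational.Unnormalised as ℚᵘ using (mkℚᵘ)
import Data.Rational.Unnormalised.Properties as ℚᵘP
open import Data.Sum using (_⊎_; inj₁; inj₂; [_,_]′)
import Data.Sum
open import Data.Vec using (_∷_; [])
import Data.Vec.Base as Vec
import Data.Vec.Properties as VecP
open import Function using (_∘_; id)
open import Relation.Binary.Definitions using (DecidableEquality)
open import Relation.Binary.PropositionalEquality
open import Relation.Nullary using (Dec; yes; no; ¬_; does; _×-dec_)

open import Algebra.Properties.CommutativeSemigroup ℕP.+-commutativeSemigroup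
  using () renaming (interchange to +-interchange)

open import Defs

-- Fractions over a natural denominator

infix 8 _/ₙ_

-- Opaque, so that unification can read the numerator and denominator off m /ₙ d.
opaque
  _/ₙ_ : ℕ → (d : ℕ) → .{{NonZero d}} → ℚ
  m /ₙ d = ℤ.+ m ℚ./ d

  toℚᵘ-/ₙ : ∀ m d .{{_ : NonZero d}} → toℚᵘ (m /ₙ d) ℚᵘ.≃ mkℚᵘ (ℤ.+ m) (pred d)
  toℚᵘ-/ₙ m (suc d) = ℚP.toℚᵘ-fromℚᵘ (mkℚᵘ (ℤ.+ m) d)

  ℕtoℚ≡/ₙ1 : ∀ m → ℕtoℚ m ≡ m /ₙ 1
  ℕtoℚ≡/ₙ1 m = refl

  recip≡1/ₙ : ∀ d .{{_ : NonZero d}} → recip d ≡ 1 /ₙ d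
  recip≡1/ₙ (suc d) = refl

  0/ₙ : ∀ d .{{_ : NonZero d}} → 0 /ₙ d ≡ 0ℚ
  0/ₙ d = ℚP.0/n≡0 d

module _ where
  open ℤ using (+_)

  private
    +*+ : ∀ m n → + m ℤ.* + n ≡ + (m * n)
    +*+ m n = sym (ℤP.pos-* m n)

    via-ℚᵘ : ∀ {p m d} .{{_ : NonZero d}} → toℚᵘ p ℚᵘ.≃ mkℚᵘ (+ m) (pred d) → p ≡ m /ₙ d
    via-ℚᵘ {m = m} {d} p≃ = ℚP.toℚᵘ-injective (ℚᵘP.≃-trans p≃ (ℚᵘP.≃-sym (toℚᵘ-/ₙ m d)))

  /ₙ-≤ : ∀ {m d m′ d′} .{{_ : NonZero d}} .{{_ : NonZero d′}} →
         m * d′ ≤ m′ * d → m /ₙ d ℚ.≤ m′ /ₙ d′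
  /ₙ-≤ {m} {d@(suc _)} {m′} {d′@(suc _)} le = ℚP.toℚᵘ-cancel-≤
    (ℚᵘP.≤-respˡ-≃ (ℚᵘP.≃-sym (toℚᵘ-/ₙ m d)) (ℚᵘP.≤-respʳ-≃ (ℚᵘP.≃-sym (toℚᵘ-/ₙ m′ d′))
      (ℚᵘ.*≤* (subst₂ ℤ._≤_ (sym (+*+ m d′)) (sym (+*+ m′ d)) (ℤ.+≤+ le)))))

  /ₙ-+ : ∀ m m′ d .{{_ : NonZero d}} → m /ₙ d ℚ.+ m′ /ₙ d ≡ (m + m′) /ₙ d
  /ₙ-+ m m′ d@(suc _) = via-ℚᵘ (ℚᵘP.≃-trans (ℚP.toℚᵘ-homo-+ (m /ₙ d) (m′ /ₙ d))
    (ℚᵘP.≃-trans (ℚᵘP.+-cong (toℚᵘ-/ₙ m d) (toℚᵘ-/ₙ m′ d)) (ℚᵘ.*≡* (begin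
      (+ m ℤ.* + d ℤ.+ + m′ ℤ.* + d) ℤ.* + d
        ≡⟨ cong₂ (λ u v → (u ℤ.+ v) ℤ.* + d) (+*+ m d) (+*+ m′ d) ⟩
      + (m * d + m′ * d) ℤ.* + d  ≡⟨ +*+ (m * d + m′ * d) d ⟩
      + ((m * d + m′ * d) * d)    ≡⟨ cong +_ (rearrange m m′ d) ⟩
      + ((m + m′) * (d * d))      ≡⟨ +*+ (m + m′) (d * d) ⟨
      + (m + m′) ℤ.* + (d * d)    ∎))))
    where
    open ≡-Reasoning
    rearrange : ∀ m m′ d → (m * d + m′ * d) * d ≡ (m + m′) * (d * d)
    rearrange = solve-∀

  ℕtoℚ-*-/ₙ : ∀ a m d .{{_ : NonZero d}} → ℕtoℚ a ℚ.* m /ₙ d ≡ (a * m) /ₙ d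
  ℕtoℚ-*-/ₙ a m d@(suc _) rewrite ℕtoℚ≡/ₙ1 a =
    via-ℚᵘ (ℚᵘP.≃-trans (ℚP.toℚᵘ-homo-* (a /ₙ 1) (m /ₙ d)) (ℚᵘP.≃-trans
      (ℚᵘP.*-cong (toℚᵘ-/ₙ a 1) (toℚᵘ-/ₙ m d)) (ℚᵘ.*≡* (begin
      (+ a ℤ.* + m) ℤ.* + d   ≡⟨ cong (ℤ._* + d) (+*+ a m) ⟩
      + (a * m) ℤ.* + d       ≡⟨ cong (λ d → + (a * m) ℤ.* + d) (ℕP.*-identityˡ d) ⟨
      + (a * m) ℤ.* + (1 * d) ∎))))
    where open ≡-Reasoning

/ₙ-cong : ∀ {m d m′ d′} .{{_ : NonZero d}} .{{_ : NonZero d′}} →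
          m * d′ ≡ m′ * d → m /ₙ d ≡ m′ /ₙ d′
/ₙ-cong eq = ℚP.≤-antisym (/ₙ-≤ (ℕP.≤-reflexive eq)) (/ₙ-≤ (ℕP.≤-reflexive (sym eq)))

ℕtoℚ-+-recip : ∀ k d .{{_ : NonZero d}} → ℕtoℚ k ℚ.+ recip d ≡ (k * d + 1) /ₙ d
ℕtoℚ-+-recip k d = begin
  ℕtoℚ k ℚ.+ recip d        ≡⟨ cong₂ ℚ._+_ (ℕtoℚ≡/ₙ1 k) (recip≡1/ₙ d) ⟩
  k /ₙ 1 ℚ.+ 1 /ₙ d         ≡⟨ cong (ℚ._+ 1 /ₙ d) (/ₙ-cong (sym (ℕP.*-identityʳ (k * d)))) ⟩
  (k * d) /ₙ d ℚ.+ 1 /ₙ d   ≡⟨ /ₙ-+ (k * d) 1 d ⟩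
  (k * d + 1) /ₙ d          ∎
  where open ≡-Reasoning

0≤/ₙ : ∀ m d .{{_ : NonZero d}} → 0ℚ ℚ.≤ m /ₙ d
0≤/ₙ m d = subst (ℚ._≤ m /ₙ d) (0/ₙ 1) (/ₙ-≤ ℕ.z≤n)

/ₙ≤1 : ∀ {m d} .{{_ : NonZero d}} → m ≤ d → m /ₙ d ℚ.≤ 1ℚ
/ₙ≤1 {m} {d} m≤d = subst (m /ₙ d ℚ.≤_) (sym (ℕtoℚ≡/ₙ1 1))
  (/ₙ-≤ (subst₂ _≤_ (sym (ℕP.*-identityʳ m)) (sym (ℕP.*-identityˡ d)) m≤d))

-- Finite sums and indicator weights

∑ : {A : Set} → List A → (A → ℕ) → ℕ
∑ []       f = 0
∑ (x ∷ xs) f = f x + ∑ xs f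

syntax ∑ xs (λ x → e) = ∑[ x ∈ xs ] e

module _ {A : Set} where

  ∑-cong : ∀ (xs : List A) {f g : A → ℕ} → (∀ x → f x ≡ g x) → ∑ xs f ≡ ∑ xs g
  ∑-cong []       f≗g = refl
  ∑-cong (x ∷ xs) f≗g = cong₂ _+_ (f≗g x) (∑-cong xs f≗g)

  ∑-congᴬ : ∀ {P : A → Set} {xs : List A} {f g : A → ℕ} → All P xs →
            (∀ {x} → P x → f x ≡ g x) → ∑ xs f ≡ ∑ xs g
  ∑-congᴬ []         f≗g = refl
  ∑-congᴬ (px ∷ pxs) f≗g = cong₂ _+_ (f≗g px) (∑-congᴬ pxs f≗g)

  ∑-singleton : ∀ (x : A) f → ∑ (x ∷ []) f ≡ f x
  ∑-singleton x f = ℕP.+-identityʳ (f x)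

  ∑-zero : ∀ (xs : List A) → ∑[ _ ∈ xs ] 0 ≡ 0
  ∑-zero []       = refl
  ∑-zero (x ∷ xs) = ∑-zero xs

  ∑-const : ∀ (xs : List A) n → ∑[ _ ∈ xs ] n ≡ length xs * n
  ∑-const []       n = refl
  ∑-const (x ∷ xs) n = cong (n +_) (∑-const xs n)

  ∑-distrib-+ : ∀ (xs : List A) f g → ∑[ x ∈ xs ] (f x + g x) ≡ ∑ xs f + ∑ xs g
  ∑-distrib-+ []       f g = refl
  ∑-distrib-+ (x ∷ xs) f g =
    trans (cong (f x + g x +_) (∑-distrib-+ xs f g)) (+-interchange (f x) (g x) (∑ xs f) (∑ xs g))

  ∑-*ˡ : ∀ (xs : List A) n f → ∑[ x ∈ xs ] (n * f x) ≡ n * ∑ xs f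
  ∑-*ˡ []       n f = sym (ℕP.*-zeroʳ n)
  ∑-*ˡ (x ∷ xs) n f = trans (cong (n * f x +_) (∑-*ˡ xs n f)) (sym (ℕP.*-distribˡ-+ n (f x) (∑ xs f)))

  ∑-++ : ∀ (xs ys : List A) f → ∑ (xs ++ ys) f ≡ ∑ xs f + ∑ ys f
  ∑-++ []       ys f = refl
  ∑-++ (x ∷ xs) ys f = trans (cong (f x +_) (∑-++ xs ys f)) (sym (ℕP.+-assoc (f x) (∑ xs f) (∑ ys f)))

  ∈⇒≤∑ : ∀ {xs : List A} {x} f → x ∈ xs → f x ≤ ∑ xs f
  ∈⇒≤∑ f (here refl)          = ℕP.m≤m+n _ _
  ∈⇒≤∑ {y ∷ _} f (there x∈xs) = ℕP.≤-trans (∈⇒≤∑ f x∈xs) (ℕP.m≤n+m _ (f y))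

module _ {A B : Set} where

  ∑-map : ∀ (xs : List A) (g : A → B) f → ∑ (map g xs) f ≡ ∑[ x ∈ xs ] f (g x)
  ∑-map []       g f = refl
  ∑-map (x ∷ xs) g f = cong (f (g x) +_) (∑-map xs g f)

  ∑-concatMap : ∀ (xs : List A) (g : A → List B) f → ∑ (concatMap g xs) f ≡ ∑[ x ∈ xs ] ∑ (g x) f
  ∑-concatMap []       g f = refl
  ∑-concatMap (x ∷ xs) g f = trans (∑-++ (g x) (concatMap g xs) f) (cong (∑ (g x) f +_) (∑-concatMap xs g f))

  ∑-comm : ∀ (xs : List A) (ys : List B) (f : A → B → ℕ) →
           ∑[ x ∈ xs ] ∑[ y ∈ ys ] f x y ≡ ∑[ y ∈ ys ] ∑[ x ∈ xs ] f x y
  ∑-comm []       ys f = sym (∑-zero ys)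
  ∑-comm (x ∷ xs) ys f = trans (cong (∑ ys (f x) +_) (∑-comm xs ys f))
                               (sym (∑-distrib-+ ys (f x) (λ y → ∑[ x ∈ xs ] f x y)))

∈-singleton-injective : ∀ {A : Set} {s t t′ : A} → t ∈ s ∷ [] → t′ ∈ s ∷ [] → t ≡ t′
∈-singleton-injective (here refl) (here refl) = refl

sumℚ-/ₙ : ∀ {A : Set} (xs : List A) {g : A → ℚ} {f : A → ℕ} d .{{_ : NonZero d}} →
          (∀ x → g x ≡ f x /ₙ d) → sumℚ (map g xs) ≡ ∑ xs f /ₙ d
sumℚ-/ₙ []       d g≗f = sym (0/ₙ d)
sumℚ-/ₙ (x ∷ xs) {f = f} d g≗f = trans (cong₂ ℚ._+_ (g≗f x) (sumℚ-/ₙ xs d g≗f)) (/ₙ-+ (f x) (∑ xs f) d)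

infix 1 _if_

_if_ : {P : Set} → ℕ → Dec P → ℕ
n if yes _ = n
n if no  _ = 0

module _ {P : Set} where

  if-yes : ∀ (d : Dec P) n → P → (n if d) ≡ n
  if-yes (yes _) n _ = refl
  if-yes (no ¬p) n p = ⊥-elim (¬p p)

  if-no : ∀ (d : Dec P) n → ¬ P → (n if d) ≡ 0
  if-no (yes p) n ¬p = ⊥-elim (¬p p)
  if-no (no _)  n _  = refl

  if-*ˡ : ∀ (d : Dec P) m n → (m * n if d) ≡ m * (n if d)
  if-*ˡ (yes _) m n = refl
  if-*ˡ (no _)  m n = sym (ℕP.*-zeroʳ m)

  if-mono-≤ : ∀ (d : Dec P) {m n} → m ≤ n → (m if d) ≤ (n if d)
  if-mono-≤ (yes _) m≤n = m≤n
  if-mono-≤ (no _)  m≤n = ℕ.z≤n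

  ∑-if : ∀ {A : Set} (xs : List A) (d : Dec P) f → ∑[ x ∈ xs ] (f x if d) ≡ (∑ xs f if d)
  ∑-if xs (yes _) f = refl
  ∑-if xs (no _)  f = ∑-zero xs

if-cong : ∀ {P R : Set} (p : Dec P) (r : Dec R) n → (P → R) → (R → P) → (n if p) ≡ (n if r)
if-cong (yes _) (yes _) n _   _   = refl
if-cong (yes p) (no ¬r) n p→r _   = ⊥-elim (¬r (p→r p))
if-cong (no ¬p) (yes r) n _   r→p = ⊥-elim (¬p (r→p r))
if-cong (no _)  (no _)  n _   _   = refl

module _ {A : Set} (_≟_ : DecidableEquality A) where

  ∑-if-∉ : ∀ {xs : List A} {x} (f : A → ℕ) → x ∉ xs → ∑[ y ∈ xs ] (f y if y ≟ x) ≡ 0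
  ∑-if-∉ {[]}     f x∉xs = refl
  ∑-if-∉ {y ∷ ys} {x} f x∉xs with y ≟ x
  ... | yes refl = ⊥-elim (x∉xs (here refl))
  ... | no _     = ∑-if-∉ f (λ x∈ys → x∉xs (there x∈ys))

  ∑-if-∈ : ∀ {xs : List A} {x} (f : A → ℕ) → Unique xs → x ∈ xs → ∑[ y ∈ xs ] (f y if y ≟ x) ≡ f x
  ∑-if-∈ {y ∷ ys} {x} f (y∉ys AllPairs.∷ !ys) x∈y∷ys with y ≟ x | x∈y∷ys
  ... | yes refl | _            = trans (cong (f y +_) (∑-if-∉ f (All¬⇒¬Any y∉ys))) (ℕP.+-identityʳ (f y))
  ... | no y≢x   | here x≡y     = ⊥-elim (y≢x (sym x≡y))
  ... | no _     | there x∈ys   = ∑-if-∈ f !ys x∈ys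

if-×-dec : ∀ {P Q R : Set} (p : Dec P) (q : Dec Q) (r : Dec R) n →
           (n if p ×-dec q ×-dec r) ≡ (((n if r) if q) if p)
if-×-dec (yes _) (yes _) (yes _) n = refl
if-×-dec (yes _) (yes _) (no _)  n = refl
if-×-dec (yes _) (no _)  _       n = refl
if-×-dec (no _)  _       _       n = refl

-- Triples and intervals in Fin n

module _ {n : ℕ} (x y z : Fin n) where

  x∈triple : x ∈ₛ triple x y z
  x∈triple = SubsetP.p⊆p∪q (⁅ y ⁆ ∪ ⁅ z ⁆) (SubsetP.x∈⁅x⁆ x)

  y∈triple : y ∈ₛ triple x y z
  y∈triple = SubsetP.q⊆p∪q ⁅ x ⁆ _ (SubsetP.p⊆p∪q ⁅ z ⁆ (SubsetP.x∈⁅x⁆ y))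

  z∈triple : z ∈ₛ triple x y z
  z∈triple = SubsetP.q⊆p∪q ⁅ x ⁆ _ (SubsetP.q⊆p∪q ⁅ y ⁆ ⁅ z ⁆ (SubsetP.x∈⁅x⁆ z))

  ∈triple⁻ : ∀ {v} → v ∈ₛ triple x y z → v ≡ x ⊎ v ≡ y ⊎ v ≡ z
  ∈triple⁻ v∈ with SubsetP.x∈p∪q⁻ ⁅ x ⁆ (⁅ y ⁆ ∪ ⁅ z ⁆) v∈
  ... | inj₁ v∈x = inj₁ (SubsetP.x∈⁅y⁆⇒x≡y x v∈x)
  ... | inj₂ v∈yz with SubsetP.x∈p∪q⁻ ⁅ y ⁆ ⁅ z ⁆ v∈yz
  ...   | inj₁ v∈y = inj₂ (inj₁ (SubsetP.x∈⁅y⁆⇒x≡y y v∈y))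
  ...   | inj₂ v∈z = inj₂ (inj₂ (SubsetP.x∈⁅y⁆⇒x≡y z v∈z))

triple-rotate : ∀ {n} (x y z : Fin n) → triple x y z ≡ triple y z x
triple-rotate x y z = trans (SubsetP.∪-comm ⁅ x ⁆ (⁅ y ⁆ ∪ ⁅ z ⁆)) (SubsetP.∪-assoc ⁅ y ⁆ ⁅ z ⁆ ⁅ x ⁆)

∣p∣≡0⇒p≡⊥ : ∀ {n} (p : Subset n) → ∣ p ∣ ≡ 0 → p ≡ Subset.⊥
∣p∣≡0⇒p≡⊥ []            _   = refl
∣p∣≡0⇒p≡⊥ (outside ∷ p) ∣p∣≡0 = cong (outside ∷_) (∣p∣≡0⇒p≡⊥ p ∣p∣≡0)

∣p∣≡1+m⇒⁅x⁆∪ : ∀ {n m} (p : Subset n) → ∣ p ∣ ≡ suc m →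
               Σ (Fin n) λ x → Σ (Subset n) λ p′ → ∣ p′ ∣ ≡ m × p ≡ ⁅ x ⁆ ∪ p′
∣p∣≡1+m⇒⁅x⁆∪ (inside ∷ p) ∣p∣≡1+m =
  Fin.zero , outside ∷ p , ℕP.suc-injective ∣p∣≡1+m , cong (inside ∷_) (sym (SubsetP.∪-identityˡ p))
∣p∣≡1+m⇒⁅x⁆∪ (outside ∷ p) ∣p∣≡1+m with ∣p∣≡1+m⇒⁅x⁆∪ p ∣p∣≡1+m
... | x , p′ , ∣p′∣≡m , p≡ = Fin.suc x , outside ∷ p′ , ∣p′∣≡m , cong (outside ∷_) p≡

∣p∣≡3⇒triple : ∀ {n} (p : Subset n) → ∣ p ∣ ≡ 3 →
               Σ (Fin n) λ x → Σ (Fin n) λ y → Σ (Fin n) λ z → p ≡ triple x y z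
∣p∣≡3⇒triple p ∣p∣≡3 with ∣p∣≡1+m⇒⁅x⁆∪ p ∣p∣≡3
... | x , p₁ , ∣p₁∣≡2 , refl with ∣p∣≡1+m⇒⁅x⁆∪ p₁ ∣p₁∣≡2
...   | y , p₂ , ∣p₂∣≡1 , refl with ∣p∣≡1+m⇒⁅x⁆∪ p₂ ∣p₂∣≡1
...     | z , p₃ , ∣p₃∣≡0 , refl =
  x , y , z , cong (λ q → ⁅ x ⁆ ∪ (⁅ y ⁆ ∪ q))
                   (trans (cong (⁅ z ⁆ ∪_) (∣p∣≡0⇒p≡⊥ p₃ ∣p₃∣≡0)) (SubsetP.∪-identityʳ ⁅ z ⁆))

∣p∣≤width : ∀ {n} (p : Subset n) lo m → (∀ v → v ∈ₛ p → lo ≤ toℕ v × toℕ v < lo + m) → ∣ p ∣ ≤ m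
∣p∣≤width []            lo       m       _ = ℕ.z≤n
∣p∣≤width (inside ∷ p)  zero     zero    p⊆ with () ← proj₂ (p⊆ Fin.zero Vec.here)
∣p∣≤width (inside ∷ p)  zero     (suc m) p⊆ = ℕ.s≤s (∣p∣≤width p 0 m λ v v∈p →
  ℕ.z≤n , ℕP.≤-pred (proj₂ (p⊆ (Fin.suc v) (Vec.there v∈p))))
∣p∣≤width (inside ∷ p)  (suc lo) m       p⊆ with () ← proj₁ (p⊆ Fin.zero Vec.here)
∣p∣≤width (outside ∷ p) zero     m       p⊆ = ∣p∣≤width p 0 m λ v v∈p →
  ℕ.z≤n , ℕP.<-trans (ℕP.n<1+n (toℕ v)) (proj₂ (p⊆ (Fin.suc v) (Vec.there v∈p)))
∣p∣≤width (outside ∷ p) (suc lo) m       p⊆ = ∣p∣≤width p lo m λ v v∈p →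
  let lo<v , v<lo+m = p⊆ (Fin.suc v) (Vec.there v∈p) in ℕP.≤-pred lo<v , ℕP.≤-pred v<lo+m

module _ {n : ℕ} (lo m : ℕ) (lo+m≤n : lo + m ≤ n) where

  private
    at : Fin m → Fin n
    at j = Fin.fromℕ< (ℕP.<-≤-trans (ℕP.+-monoʳ-< lo (FinP.toℕ<n j)) lo+m≤n)

    toℕ-at : ∀ j → toℕ (at j) ≡ lo + toℕ j
    toℕ-at j = FinP.toℕ-fromℕ< _

  interval : List (Fin n)
  interval = map at (allFin m)

  length-interval : length interval ≡ m
  length-interval = trans (ListP.length-map at (allFin m)) (ListP.length-tabulate {n = m} (λ i → i))

  interval-unique : Unique interval
  interval-unique = UniqueP.map⁺ at-injective (UniqueP.allFin⁺ m)
    where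
    at-injective : ∀ {i j} → at i ≡ at j → i ≡ j
    at-injective {i} {j} eq = FinP.toℕ-injective
      (ℕP.+-cancelˡ-≡ lo _ _ (trans (sym (toℕ-at i)) (trans (cong toℕ eq) (toℕ-at j))))

  ∈-interval⁻ : ∀ {v} → v ∈ interval → lo ≤ toℕ v × toℕ v < lo + m
  ∈-interval⁻ v∈ with ∈P.∈-map⁻ at v∈
  ... | j , _ , refl = subst (lo ≤_) (sym (toℕ-at j)) (ℕP.m≤m+n lo (toℕ j)) ,
                       subst (_< lo + m) (sym (toℕ-at j)) (ℕP.+-monoʳ-< lo (FinP.toℕ<n j))

  ∈-interval⁺ : ∀ {v} → lo ≤ toℕ v → toℕ v < lo + m → v ∈ interval
  ∈-interval⁺ {v} lo≤v v<lo+m = subst (_∈ interval) at-j≡v (∈P.∈-map⁺ at (∈P.∈-allFin j))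
    where
    v∸lo<m : toℕ v ∸ lo < m
    v∸lo<m = ℕP.+-cancelˡ-< lo _ _ (subst (_< lo + m) (sym (ℕP.m+[n∸m]≡n lo≤v)) v<lo+m)
    j = Fin.fromℕ< v∸lo<m
    at-j≡v : at j ≡ v
    at-j≡v = FinP.toℕ-injective (trans (toℕ-at j)
               (trans (cong (lo +_) (FinP.toℕ-fromℕ< v∸lo<m)) (ℕP.m+[n∸m]≡n lo≤v)))

  first : 0 < m → Fin n
  first 0<m = Fin.fromℕ< (ℕP.<-≤-trans (ℕP.m<m+n lo 0<m) lo+m≤n)

  first∈interval : (0<m : 0 < m) → first 0<m ∈ interval
  first∈interval 0<m = ∈-interval⁺ (ℕP.≤-reflexive (sym (FinP.toℕ-fromℕ< _)))
                                   (subst (_< lo + m) (sym (FinP.toℕ-fromℕ< _)) (ℕP.m<m+n lo 0<m))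

-- Weighted triples and the tilings they define

_≟ₛ_ : ∀ {n} → DecidableEquality (Subset n)
_≟ₛ_ = VecP.≡-dec Bool._≟_

record WeightedTriple (n : ℕ) : Set where
  constructor ⟨_,_,_∣_,_,_⟩
  field
    p q r : Fin n
    α β γ : ℕ
open WeightedTriple

module _ {n : ℕ} where

  vertices : WeightedTriple n → Subset n
  vertices t = triple (p t) (q t) (r t)

  load : Fin n → WeightedTriple n → ℕ
  load v t = (α t if v ≟ p t) + (β t if v ≟ q t) + (γ t if v ≟ r t)

  total : WeightedTriple n → ℕ
  total t = α t + β t + γ t

  ∑-load : ∀ t → ∑[ v ∈ allFin n ] load v t ≡ total t
  ∑-load t = begin
    ∑[ v ∈ allFin n ] (at-p v + at-q v + at-r v)
      ≡⟨ ∑-distrib-+ (allFin n) (λ v → at-p v + at-q v) at-r ⟩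
    ∑[ v ∈ allFin n ] (at-p v + at-q v) + ∑ (allFin n) at-r
      ≡⟨ cong (_+ ∑ (allFin n) at-r) (∑-distrib-+ (allFin n) at-p at-q) ⟩
    ∑ (allFin n) at-p + ∑ (allFin n) at-q + ∑ (allFin n) at-r
      ≡⟨ cong₂ _+_ (cong₂ _+_ (once (p t) (α t)) (once (q t) (β t))) (once (r t) (γ t)) ⟩
    total t ∎
    where
    open ≡-Reasoning
    at-p at-q at-r : Fin n → ℕ
    at-p v = α t if v ≟ p t
    at-q v = β t if v ≟ q t
    at-r v = γ t if v ≟ r t
    once : ∀ x w → ∑[ v ∈ allFin n ] (w if v ≟ x) ≡ w
    once x w = ∑-if-∈ _≟_ (λ _ → w) (UniqueP.allFin⁺ n) (∈P.∈-allFin x)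

  load-outside : ∀ {v} t → v ∉ₛ vertices t → load v t ≡ 0
  load-outside {v} t v∉ =
    cong₂ _+_ (cong₂ _+_ (if-no (v ≟ p t) (α t) (λ { refl → v∉ (x∈triple (p t) (q t) (r t)) }))
                         (if-no (v ≟ q t) (β t) (λ { refl → v∉ (y∈triple (p t) (q t) (r t)) })))
              (if-no (v ≟ r t) (γ t) (λ { refl → v∉ (z∈triple (p t) (q t) (r t)) }))

  load-p : ∀ t → p t ≢ q t → p t ≢ r t → load (p t) t ≡ α t
  load-p t p≢q p≢r
    rewrite if-yes (p t ≟ p t) (α t) refl | if-no (p t ≟ q t) (β t) p≢q | if-no (p t ≟ r t) (γ t) p≢r
    = trans (ℕP.+-identityʳ (α t + 0)) (ℕP.+-identityʳ (α t))

  load-q : ∀ t → q t ≢ p t → q t ≢ r t → load (q t) t ≡ β t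
  load-q t q≢p q≢r
    rewrite if-no (q t ≟ p t) (α t) q≢p | if-yes (q t ≟ q t) (β t) refl | if-no (q t ≟ r t) (γ t) q≢r
    = ℕP.+-identityʳ (β t)

  load-r : ∀ t → r t ≢ p t → r t ≢ q t → load (r t) t ≡ γ t
  load-r t r≢p r≢q
    rewrite if-no (r t ≟ p t) (α t) r≢p | if-no (r t ≟ q t) (β t) r≢q | if-yes (r t ≟ r t) (γ t) refl
    = refl

record Shaped (a b c X Y Z : ℕ) : Set where
  constructor shaped
  field
    X≤Y   : X ≤ Y
    Y≤Z   : Y ≤ Z
    aY≤bX : a * Y ≤ b * X
    bZ≤cY : b * Z ≤ c * Y

module _ {a b c : ℕ} where

  Shaped-zero : Shaped a b c 0 0 0
  Shaped-zero = shaped ℕ.z≤n ℕ.z≤n (ℕP.≤-reflexive (trans (ℕP.*-zeroʳ a) (sym (ℕP.*-zeroʳ b))))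
                                   (ℕP.≤-reflexive (trans (ℕP.*-zeroʳ b) (sym (ℕP.*-zeroʳ c))))

  Shaped-zeros : ∀ {X Y Z} → X ≡ 0 → Y ≡ 0 → Z ≡ 0 → Shaped a b c X Y Z
  Shaped-zeros refl refl refl = Shaped-zero

  Shaped-+ : ∀ {X Y Z X′ Y′ Z′} → Shaped a b c X Y Z → Shaped a b c X′ Y′ Z′ →
             Shaped a b c (X + X′) (Y + Y′) (Z + Z′)
  Shaped-+ {X} {Y} {Z} {X′} {Y′} {Z′} (shaped X≤Y Y≤Z aY≤bX bZ≤cY) (shaped X′≤Y′ Y′≤Z′ aY′≤bX′ bZ′≤cY′) =
    shaped (ℕP.+-mono-≤ X≤Y X′≤Y′) (ℕP.+-mono-≤ Y≤Z Y′≤Z′)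
      (subst₂ _≤_ (sym (ℕP.*-distribˡ-+ a Y Y′)) (sym (ℕP.*-distribˡ-+ b X X′))
                  (ℕP.+-mono-≤ aY≤bX aY′≤bX′))
      (subst₂ _≤_ (sym (ℕP.*-distribˡ-+ b Z Z′)) (sym (ℕP.*-distribˡ-+ c Y Y′))
                  (ℕP.+-mono-≤ bZ≤cY bZ′≤cY′))

  Shaped-if : ∀ {P : Set} (d : Dec P) {X Y Z} → (P → Shaped a b c X Y Z) →
              Shaped a b c (X if d) (Y if d) (Z if d)
  Shaped-if (yes p) shaped-if-P = shaped-if-P p
  Shaped-if (no _)  _           = Shaped-zero

  Shaped-∑ : ∀ {A : Set} (xs : List A) (f g h : A → ℕ) →
             All (λ x → Shaped a b c (f x) (g x) (h x)) xs → Shaped a b c (∑ xs f) (∑ xs g) (∑ xs h)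
  Shaped-∑ []       f g h []       = Shaped-zero
  Shaped-∑ (x ∷ xs) f g h (s ∷ ss) = Shaped-+ s (Shaped-∑ xs f g h ss)

  Shaped⇒ℚ : ∀ {X Y Z} M .{{_ : NonZero M}} → Shaped a b c X Y Z →
             (X /ₙ M ℚ.≤ Y /ₙ M) × (Y /ₙ M ℚ.≤ Z /ₙ M) ×
             (ℕtoℚ a ℚ.* Y /ₙ M ℚ.≤ ℕtoℚ b ℚ.* X /ₙ M) ×
             (ℕtoℚ b ℚ.* Z /ₙ M ℚ.≤ ℕtoℚ c ℚ.* Y /ₙ M)

  Shaped⇒ℚ {X} {Y} {Z} M (shaped X≤Y Y≤Z aY≤bX bZ≤cY) =
    /ₙ-≤ (ℕP.*-monoˡ-≤ M X≤Y) , /ₙ-≤ (ℕP.*-monoˡ-≤ M Y≤Z) ,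
    subst₂ ℚ._≤_ (sym (ℕtoℚ-*-/ₙ a Y M)) (sym (ℕtoℚ-*-/ₙ b X M)) (/ₙ-≤ (ℕP.*-monoˡ-≤ M aY≤bX)) ,
    subst₂ ℚ._≤_ (sym (ℕtoℚ-*-/ₙ b Z M)) (sym (ℕtoℚ-*-/ₙ c Y M)) (/ₙ-≤ (ℕP.*-monoˡ-≤ M bZ≤cY))

Shaped-scaled : ∀ {a b c} t → a ≤ b → b ≤ c → Shaped a b c (t * a) (t * b) (t * c)
Shaped-scaled {a} {b} {c} t a≤b b≤c =
  shaped (ℕP.*-monoʳ-≤ t a≤b) (ℕP.*-monoʳ-≤ t b≤c)
         (ℕP.≤-reflexive (swap-middle a t b)) (ℕP.≤-reflexive (swap-middle b t c))
  where
  swap-middle : ∀ x t y → x * (t * y) ≡ y * (t * x)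
  swap-middle = solve-∀

Shaped-constant : ∀ {a b c} t → a ≤ b → b ≤ c → Shaped a b c t t t
Shaped-constant t a≤b b≤c = shaped ℕP.≤-refl ℕP.≤-refl (ℕP.*-monoˡ-≤ t a≤b) (ℕP.*-monoˡ-≤ t b≤c)

SelfShaped : (a b c : ℕ) {n : ℕ} → WeightedTriple n → Set
SelfShaped a b c t = Shaped a b c (load (p t) t) (load (q t) t) (load (r t) t)

data Coarse (K M : ℕ) : ℕ → Set where
  vanishing : Coarse K M 0
  heavy     : ∀ {n} → M ≤ K * n → Coarse K M n

module _ {K M : ℕ} where

  Coarse-+ : ∀ {m n} → Coarse K M m → Coarse K M n → Coarse K M (m + n)
  Coarse-+         vanishing     coarse-n = coarse-n
  Coarse-+ {m} {n} (heavy M≤Km) _         = heavy (ℕP.≤-trans M≤Km (ℕP.*-monoʳ-≤ K (ℕP.m≤m+n m n)))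

  Coarse-if : ∀ {P : Set} (d : Dec P) {n} → Coarse K M n → Coarse K M (n if d)
  Coarse-if (yes _) coarse = coarse
  Coarse-if (no _)  _      = vanishing

  Coarse-∑ : ∀ {A : Set} (xs : List A) (f : A → ℕ) → All (Coarse K M ∘ f) xs → Coarse K M (∑ xs f)
  Coarse-∑ []       f []       = vanishing
  Coarse-∑ (x ∷ xs) f (c ∷ cs) = Coarse-+ c (Coarse-∑ xs f cs)

  Coarse⇒recip≤ : ∀ {n} .{{_ : NonZero K}} .{{_ : NonZero M}} → Coarse K M n → n /ₙ M ≢ 0ℚ →
                  recip K ℚ.≤ n /ₙ M
  Coarse⇒recip≤     vanishing     0/M≢0 = ⊥-elim (0/M≢0 (0/ₙ M))
  Coarse⇒recip≤ {n} (heavy M≤Kn) _     = subst (ℚ._≤ n /ₙ M) (sym (recip≡1/ₙ K))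
    (/ₙ-≤ (subst₂ _≤_ (sym (ℕP.*-identityˡ M)) (ℕP.*-comm K n) M≤Kn))

CoarseTriple : (K M : ℕ) {n : ℕ} → WeightedTriple n → Set
CoarseTriple K M t = Coarse K M (α t) × Coarse K M (β t) × Coarse K M (γ t)

module FromWeightedTriples
  (a b c : ℕ) {n : ℕ} (L : ThreeGraph n) (M : ℕ) .{{_ : NonZero M}}
  (D : List (WeightedTriple n))
  (D⊆L : All (λ t → vertices t ∈E L) D)
  (vertices-injective : ∀ {t t′} → t ∈ D → t′ ∈ D → vertices t ≡ vertices t′ → t ≡ t′)
  (self-shaped : All (SelfShaped a b c) D)
  (capacity : ∀ v → ∑ D (load v) ≤ M)
  where

  H : Fin n → Subset n → ℕ
  H v e = ∑[ t ∈ D ] (load v t if e ≟ₛ vertices t)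

  h : Fin n → Subset n → ℚ
  h v e = H v e /ₙ M

  ∑-edges-H : ∀ v → ∑[ e ∈ edges L ] H v e ≡ ∑ D (load v)
  ∑-edges-H v = trans (∑-comm (edges L) D (λ e t → load v t if e ≟ₛ vertices t))
                      (∑-congᴬ D⊆L (λ {t} t∈L → ∑-if-∈ _≟ₛ_ (λ _ → load v t) (nodup L) t∈L))

  H-outside : ∀ {v e} → v ∉ₛ e → H v e ≡ 0
  H-outside {v} {e} v∉e = trans (∑-cong D vanishes) (∑-zero D)
    where
    vanishes : ∀ t → (load v t if e ≟ₛ vertices t) ≡ 0
    vanishes t with e ≟ₛ vertices t
    ... | yes refl = load-outside t v∉e
    ... | no _     = refl

  H≤M : ∀ v {e} → e ∈E L → H v e ≤ M
  H≤M v e∈L = ℕP.≤-trans (∈⇒≤∑ (H v) e∈L) (subst (_≤ M) (sym (∑-edges-H v)) (capacity v))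

  H-unused : ∀ {e} → ¬ Any (λ t → e ≡ vertices t) D → ∀ v → H v e ≡ 0
  H-unused {e} e∉D v =
    trans (∑-congᴬ (¬Any⇒All¬ D e∉D) (λ {t} e≢t → if-no (e ≟ₛ vertices t) (load v t) e≢t)) (∑-zero D)

  H-shaped-on : ∀ {t₀} → t₀ ∈ D →
                Shaped a b c (H (p t₀) (vertices t₀)) (H (q t₀) (vertices t₀)) (H (r t₀) (vertices t₀))
  H-shaped-on {t₀} t₀∈D = Shaped-∑ D (on (p t₀)) (on (q t₀)) (on (r t₀)) (All.tabulate λ {t} t∈D →
    Shaped-if (vertices t₀ ≟ₛ vertices t) λ same →
      subst (λ t → Shaped a b c (load (p t₀) t) (load (q t₀) t) (load (r t₀) t))
            (vertices-injective t₀∈D t∈D same) (All.lookup self-shaped t₀∈D))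
    where
    on : Fin n → WeightedTriple n → ℕ
    on v t = load v t if vertices t₀ ≟ₛ vertices t

  H-shaped : ∀ e → e ∈E L → Σ (Fin n) λ x → Σ (Fin n) λ y → Σ (Fin n) λ z →
             e ≡ triple x y z × Shaped a b c (H x e) (H y e) (H z e)
  H-shaped e e∈L with any? (λ t → e ≟ₛ vertices t) D
  ... | yes e∈D with find e∈D
  ...   | t₀ , t₀∈D , refl = p t₀ , q t₀ , r t₀ , refl , H-shaped-on t₀∈D
  H-shaped e e∈L | no e∉D with ∣p∣≡3⇒triple e (All.lookup (size3 L) e∈L)

  ... | x , y , z , e≡xyz =
    x , y , z , e≡xyz , Shaped-zeros (H-unused e∉D x) (H-unused e∉D y) (H-unused e∉D z)

  tiling : IsFracHomTiling a b c L h
  tiling = record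
    { range    = λ v e e∈L → 0≤/ₙ (H v e) M , /ₙ≤1 (H≤M v e∈L)
    ; support  = λ v e _ v∉e → trans (cong (λ m → m /ₙ M) (H-outside v∉e)) (0/ₙ M)
    ; capacity = λ v → subst (ℚ._≤ 1ℚ) (sym (sumℚ-/ₙ (edges L) {f = H v} M λ _ → refl))
                             (/ₙ≤1 (subst (_≤ M) (sym (∑-edges-H v)) (capacity v)))
    ; shape    = λ e e∈L → let x , y , z , e≡xyz , xyz-shaped = H-shaped e e∈L in
                           x , y , z , e≡xyz , Shaped⇒ℚ M xyz-shaped
    }

  weight-h : weight L h ≡ ∑ D total /ₙ M
  weight-h = trans (sumℚ-/ₙ (edges L) M (λ e → sumℚ-/ₙ (allFin n) {f = λ v → H v e} M λ _ → refl))
                   (cong (λ m → m /ₙ M) ∑∑H≡∑total)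
    where
    open ≡-Reasoning
    ∑∑H≡∑total : ∑[ e ∈ edges L ] ∑[ v ∈ allFin n ] H v e ≡ ∑ D total
    ∑∑H≡∑total = begin
      ∑[ e ∈ edges L ] ∑[ v ∈ allFin n ] H v e   ≡⟨ ∑-comm (edges L) (allFin n) (λ e v → H v e) ⟩
      ∑[ v ∈ allFin n ] ∑[ e ∈ edges L ] H v e   ≡⟨ ∑-cong (allFin n) ∑-edges-H ⟩
      ∑[ v ∈ allFin n ] ∑[ t ∈ D ] load v t      ≡⟨ ∑-comm (allFin n) D load ⟩
      ∑[ t ∈ D ] ∑[ v ∈ allFin n ] load v t      ≡⟨ ∑-cong D ∑-load ⟩
      ∑ D total                                  ∎

  hmin : ∀ K .{{_ : NonZero K}} → All (CoarseTriple K M) D → hminAtLeast L h (recip K)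
  hmin K coarse v e _ =
    Coarse⇒recip≤ (Coarse-∑ D (λ t → load v t if e ≟ₛ vertices t) (All.map coarse-term coarse))

    where
    coarse-term : ∀ {t} → CoarseTriple K M t → Coarse K M (load v t if e ≟ₛ vertices t)
    coarse-term {t} (cα , cβ , cγ) = Coarse-if (e ≟ₛ vertices t)
      (Coarse-+ (Coarse-+ (Coarse-if (v ≟ p t) cα) (Coarse-if (v ≟ q t) cβ)) (Coarse-if (v ≟ r t) cγ))

module Construction (a b c : ℕ) (1≤a : 1 ≤ a) (a≤b : a ≤ b) (b≤c : b ≤ c) (a<c : a < c)
                    (L : ThreeGraph (2 + (a + b + c))) (K⊆L : containsK a b c L) where

  k : ℕ
  k = a + b + c

  1≤b : 1 ≤ b
  1≤b = ℕP.≤-trans 1≤a a≤b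

  1≤c : 1 ≤ c
  1≤c = ℕP.≤-trans 1≤b b≤c

  2≤c : 2 ≤ c
  2≤c = ℕP.≤-trans (ℕ.s≤s 1≤a) a<c

  a≤c : a ≤ c
  a≤c = ℕP.≤-trans a≤b b≤c

  M : ℕ
  M = 2 * (a * a * b * c)

  instance
    abc≢0 : NonZero (a * b * c)
    abc≢0 = ℕ.>-nonZero (ℕP.*-mono-≤ (ℕP.*-mono-≤ 1≤a 1≤b) 1≤c)

    bcc≢0 : NonZero (b * c * c)
    bcc≢0 = ℕ.>-nonZero (ℕP.*-mono-≤ (ℕP.*-mono-≤ 1≤b 1≤c) 1≤c)

    M≢0 : NonZero M
    M≢0 = ℕ.>-nonZero (ℕP.*-mono-≤ {1} {2} (ℕ.s≤s ℕ.z≤n)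
                        (ℕP.*-mono-≤ (ℕP.*-mono-≤ (ℕP.*-mono-≤ 1≤a 1≤a) 1≤b) 1≤c))

  private
    A-fits : a ≤ k
    A-fits = ℕP.≤-trans (ℕP.m≤m+n a b) (ℕP.m≤m+n (a + b) c)
    B-fits : a + b ≤ k
    B-fits = ℕP.m≤m+n (a + b) c

  partA partB partC : List (Fin k)
  partA = interval 0 a A-fits
  partB = interval a b B-fits
  partC = interval (a + b) c ℕP.≤-refl

  ∈A⇒< : ∀ {x} → x ∈ partA → toℕ x < a
  ∈A⇒< x∈A = proj₂ (∈-interval⁻ 0 a A-fits x∈A)

  ∈C⇒≥ : ∀ {z} → z ∈ partC → a + b ≤ toℕ z
  ∈C⇒≥ z∈C = proj₁ (∈-interval⁻ (a + b) c ℕP.≤-refl z∈C)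

  A≢B : ∀ {x y} → x ∈ partA → y ∈ partB → x ≢ y
  A≢B x∈A y∈B refl = ℕP.<⇒≱ (∈A⇒< x∈A) (proj₁ (∈-interval⁻ a b B-fits y∈B))

  A≢C : ∀ {x z} → x ∈ partA → z ∈ partC → x ≢ z
  A≢C x∈A z∈C refl = ℕP.<⇒≱ (∈A⇒< x∈A) (ℕP.≤-trans (ℕP.m≤m+n a b) (∈C⇒≥ z∈C))

  B≢C : ∀ {y z} → y ∈ partB → z ∈ partC → y ≢ z
  B≢C y∈B z∈C refl = ℕP.<⇒≱ (proj₂ (∈-interval⁻ a b B-fits y∈B)) (∈C⇒≥ z∈C)

  inK-injective : ∀ {x y : Fin k} → inK x ≡ inK y → x ≡ y
  inK-injective {x} {y} = FinP.↑ʳ-injective 2 x y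

  kEdge∈L : ∀ {x y z} → x ∈ partA → y ∈ partB → z ∈ partC → triple (inK x) (inK y) (inK z) ∈E L
  kEdge∈L x∈A y∈B z∈C = K⊆L _ _ _ (∈A⇒< x∈A) (∈-interval⁻ a b B-fits y∈B) (∈C⇒≥ z∈C)

  share : Fin k → Fin k → Fin k → Fin k → ℕ
  share i x y z = (a * a if x ≟ i) + (a * b if y ≟ i) + (a * c if z ≟ i)

  kTriple : ℕ → Fin k → Fin k → Fin k → WeightedTriple (2 + k)
  kTriple m x y z = ⟨ inK x , inK y , inK z ∣ m * a * a , m * a * b , m * a * c ⟩

  load-kTriple : ∀ m i x y z → load (inK i) (kTriple m x y z) ≡ m * share i x y z
  load-kTriple m i x y z = begin
    (m * a * a if inK i ≟ inK x) + (m * a * b if inK i ≟ inK y) + (m * a * c if inK i ≟ inK z)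
      ≡⟨ cong₂ _+_ (cong₂ _+_ (part x a) (part y b)) (part z c) ⟩
    m * (a * a if x ≟ i) + m * (a * b if y ≟ i) + m * (a * c if z ≟ i)
      ≡⟨ distrib m _ _ _ ⟩
    m * share i x y z ∎
    where
    open ≡-Reasoning
    part : ∀ w n → (m * a * n if inK i ≟ inK w) ≡ m * (a * n if w ≟ i)
    part w n = trans (if-cong (inK i ≟ inK w) (w ≟ i) _ (sym ∘ inK-injective) (cong inK ∘ sym))
                     (trans (cong (λ v → v if w ≟ i) (ℕP.*-assoc m a n)) (if-*ˡ (w ≟ i) m (a * n)))
    distrib : ∀ m x y z → m * x + m * y + m * z ≡ m * (x + y + z)
    distrib = solve-∀

  kTriple-vertices-injective : ∀ {x y z x′ y′ z′} → x ∈ partA → y ∈ partB → z ∈ partC →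
                               x′ ∈ partA → y′ ∈ partB → z′ ∈ partC →
                               triple (inK x) (inK y) (inK z) ≡ triple (inK x′) (inK y′) (inK z′) →
                               x ≡ x′ × y ≡ y′ × z ≡ z′
  kTriple-vertices-injective {x} {y} {z} {x′} {y′} {z′} x∈A y∈B z∈C x′∈A y′∈B z′∈C same =
    [ id , [ ⊥-elim ∘ A≢B x∈A y′∈B , ⊥-elim ∘ A≢C x∈A z′∈C ]′ ]′ (located (x∈triple (inK x) (inK y) (inK z))) ,
    [ ⊥-elim ∘ A≢B x′∈A y∈B ∘ sym , [ id , ⊥-elim ∘ B≢C y∈B z′∈C ]′ ]′ (located (y∈triple (inK x) (inK y) (inK z))) ,
    [ ⊥-elim ∘ A≢C x′∈A z∈C ∘ sym , [ ⊥-elim ∘ B≢C y′∈B z∈C ∘ sym , id ]′ ]′ (located (z∈triple (inK x) (inK y) (inK z)))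
    where
    located : ∀ {w} → inK w ∈ₛ triple (inK x) (inK y) (inK z) → w ≡ x′ ⊎ w ≡ y′ ⊎ w ≡ z′
    located {w} w∈ = Data.Sum.map inK-injective (Data.Sum.map inK-injective inK-injective)
                       (∈triple⁻ (inK x′) (inK y′) (inK z′) (subst (inK w ∈ₛ_) same w∈))

  kTriple-self-shaped : ∀ m {x y z} → x ∈ partA → y ∈ partB → z ∈ partC → SelfShaped a b c (kTriple m x y z)
  kTriple-self-shaped m {x} {y} {z} x∈A y∈B z∈C
    rewrite load-p (kTriple m x y z) (A≢B x∈A y∈B ∘ inK-injective) (A≢C x∈A z∈C ∘ inK-injective)
          | load-q (kTriple m x y z) (A≢B x∈A y∈B ∘ sym ∘ inK-injective) (B≢C y∈B z∈C ∘ inK-injective)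
          | load-r (kTriple m x y z) (A≢C x∈A z∈C ∘ sym ∘ inK-injective) (B≢C y∈B z∈C ∘ sym ∘ inK-injective)
    = Shaped-scaled (m * a) a≤b b≤c

  Coarse-≥a² : ∀ {w} → a * a ≤ w → Coarse (b * c * c) M w
  Coarse-≥a² {w} a²≤w = heavy (begin
    2 * (a * a * b * c)       ≡⟨ ℕP.*-comm 2 (a * a * b * c) ⟩
    a * a * b * c * 2         ≤⟨ ℕP.*-monoʳ-≤ (a * a * b * c) 2≤c ⟩
    a * a * b * c * c         ≡⟨ rearrange a b c ⟩
    b * c * c * (a * a)       ≤⟨ ℕP.*-monoʳ-≤ (b * c * c) a²≤w ⟩
    b * c * c * w             ∎)
    where
    open ℕP.≤-Reasoning
    rearrange : ∀ a b c → a * a * b * c * c ≡ b * c * c * (a * a)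
    rearrange = solve-∀

  kTriple-coarse : ∀ m x y z → CoarseTriple (b * c * c) M (kTriple m x y z)
  kTriple-coarse zero    x y z = vanishing , vanishing , vanishing
  kTriple-coarse (suc m) x y z =
    Coarse-≥a² (ℕP.*-monoˡ-≤ a a≤ma) , Coarse-≥a² (ℕP.*-mono-≤ a≤ma a≤b) ,
    Coarse-≥a² (ℕP.*-mono-≤ a≤ma a≤c)
    where
    a≤ma : a ≤ suc m * a
    a≤ma = ℕP.m≤m+n a (m * a)

  ∑ᴷ : (Fin k → Fin k → Fin k → ℕ) → ℕ
  ∑ᴷ F = ∑[ x ∈ partA ] ∑[ y ∈ partB ] ∑[ z ∈ partC ] F x y z

  ∑ᴷ-cong : ∀ {F G : Fin k → Fin k → Fin k → ℕ} → (∀ x y z → F x y z ≡ G x y z) → ∑ᴷ F ≡ ∑ᴷ G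
  ∑ᴷ-cong F≗G = ∑-cong partA λ x → ∑-cong partB λ y → ∑-cong partC λ z → F≗G x y z

  ∑ᴷ-distrib-+ : ∀ F G → ∑ᴷ (λ x y z → F x y z + G x y z) ≡ ∑ᴷ F + ∑ᴷ G
  ∑ᴷ-distrib-+ F G =
    trans (∑-cong partA λ x → trans (∑-cong partB λ y → ∑-distrib-+ partC (F x y) (G x y))
                                    (∑-distrib-+ partB _ _))
          (∑-distrib-+ partA _ _)

  ∑ᴷ-*ˡ : ∀ n F → ∑ᴷ (λ x y z → n * F x y z) ≡ n * ∑ᴷ F
  ∑ᴷ-*ˡ n F =
    trans (∑-cong partA λ x → trans (∑-cong partB λ y → ∑-*ˡ partC n (F x y)) (∑-*ˡ partB n _))
          (∑-*ˡ partA n _)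

  ∑A-const : ∀ n → ∑[ _ ∈ partA ] n ≡ a * n
  ∑A-const n = trans (∑-const partA n) (cong (_* n) (length-interval 0 a A-fits))

  ∑B-const : ∀ n → ∑[ _ ∈ partB ] n ≡ b * n
  ∑B-const n = trans (∑-const partB n) (cong (_* n) (length-interval a b B-fits))

  ∑C-const : ∀ n → ∑[ _ ∈ partC ] n ≡ c * n
  ∑C-const n = trans (∑-const partC n) (cong (_* n) (length-interval (a + b) c ℕP.≤-refl))

  ∑ᴷ-const : ∀ n → ∑ᴷ (λ _ _ _ → n) ≡ a * (b * (c * n))
  ∑ᴷ-const n = trans (∑-cong partA λ _ → trans (∑-cong partB λ _ → ∑C-const n) (∑B-const (c * n)))
                     (∑A-const (b * (c * n)))

  ∑ᴷ-first : ∀ f → ∑ᴷ (λ x _ _ → f x) ≡ b * (c * ∑ partA f)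
  ∑ᴷ-first f = trans (∑-cong partA λ x → trans (∑-cong partB λ _ → ∑C-const (f x)) (∑B-const (c * f x)))
                     (trans (∑-*ˡ partA b (λ x → c * f x)) (cong (b *_) (∑-*ˡ partA c f)))

  ∑ᴷ-second : ∀ f → ∑ᴷ (λ _ y _ → f y) ≡ a * (c * ∑ partB f)
  ∑ᴷ-second f = trans (∑-cong partA λ _ → trans (∑-cong partB λ y → ∑C-const (f y)) (∑-*ˡ partB c f))
                      (∑A-const (c * ∑ partB f))

  ∑ᴷ-third : ∀ f → ∑ᴷ (λ _ _ z → f z) ≡ a * (b * ∑ partC f)
  ∑ᴷ-third f = trans (∑-cong partA λ _ → ∑B-const (∑ partC f)) (∑A-const (b * ∑ partC f))

  ∑ᴷ-share : ∀ i → ∑ᴷ (share i) ≡ a * a * b * c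
  ∑ᴷ-share i = begin
    ∑ᴷ (λ x y z → onA x + onB y + onC z)
      ≡⟨ ∑ᴷ-distrib-+ (λ x y _ → onA x + onB y) (λ _ _ z → onC z) ⟩
    ∑ᴷ (λ x y _ → onA x + onB y) + ∑ᴷ (λ _ _ z → onC z)
      ≡⟨ cong (_+ ∑ᴷ (λ _ _ z → onC z)) (∑ᴷ-distrib-+ (λ x _ _ → onA x) (λ _ y _ → onB y)) ⟩
    ∑ᴷ (λ x _ _ → onA x) + ∑ᴷ (λ _ y _ → onB y) + ∑ᴷ (λ _ _ z → onC z)
      ≡⟨ cong₂ _+_ (cong₂ _+_ (∑ᴷ-first onA) (∑ᴷ-second onB)) (∑ᴷ-third onC) ⟩
    b * (c * hits partA (a * a)) + a * (c * hits partB (a * b)) + a * (b * hits partC (a * c))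
      ≡⟨ by-part (toℕ i ℕP.<? a) (toℕ i ℕP.<? a + b) ⟩
    a * a * b * c ∎
    where
    open ≡-Reasoning
    onA onB onC : Fin k → ℕ
    onA x = a * a if x ≟ i
    onB y = a * b if y ≟ i
    onC z = a * c if z ≟ i

    hits : List (Fin k) → ℕ → ℕ
    hits part w = ∑[ x ∈ part ] (w if x ≟ i)
    hit : ∀ {part} w → Unique part → i ∈ part → hits part w ≡ w
    hit w !part i∈part = ∑-if-∈ _≟_ (λ _ → w) !part i∈part
    miss : ∀ {part} w → i ∉ part → hits part w ≡ 0
    miss w i∉part = ∑-if-∉ _≟_ (λ _ → w) i∉part
    in-A : ∀ a b c → b * (c * (a * a)) + a * (c * 0) + a * (b * 0) ≡ a * a * b * c
    in-A = solve-∀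
    in-B : ∀ a b c → b * (c * 0) + a * (c * (a * b)) + a * (b * 0) ≡ a * a * b * c
    in-B = solve-∀
    in-C : ∀ a b c → b * (c * 0) + a * (c * 0) + a * (b * (a * c)) ≡ a * a * b * c
    in-C = solve-∀
    by-part : Dec (toℕ i < a) → Dec (toℕ i < a + b) →
              b * (c * hits partA (a * a)) + a * (c * hits partB (a * b)) + a * (b * hits partC (a * c))
              ≡ a * a * b * c
    by-part (yes i<a) _
      rewrite hit (a * a) (interval-unique 0 a A-fits) (∈-interval⁺ 0 a A-fits ℕ.z≤n i<a)
            | miss (a * b) (ℕP.<⇒≱ i<a ∘ proj₁ ∘ ∈-interval⁻ a b B-fits)
            | miss (a * c) (ℕP.<⇒≱ (ℕP.<-≤-trans i<a (ℕP.m≤m+n a b)) ∘ ∈C⇒≥) = in-A a b c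
    by-part (no i≮a) (yes i<a+b)
      rewrite miss (a * a) (i≮a ∘ ∈A⇒<)
            | hit (a * b) (interval-unique a b B-fits) (∈-interval⁺ a b B-fits (ℕP.≮⇒≥ i≮a) i<a+b)
            | miss (a * c) (ℕP.<⇒≱ i<a+b ∘ ∈C⇒≥) = in-B a b c
    by-part (no i≮a) (no i≮a+b)
      rewrite miss (a * a) (i≮a ∘ ∈A⇒<)
            | miss (a * b) (i≮a+b ∘ proj₂ ∘ ∈-interval⁻ a b B-fits)
            | hit (a * c) (interval-unique (a + b) c ℕP.≤-refl)
                          (∈-interval⁺ (a + b) c ℕP.≤-refl (ℕP.≮⇒≥ i≮a+b) (FinP.toℕ<n i)) = in-C a b c

  TilingWithBounds : Set
  TilingWithBounds = Σ (Fin (2 + k) → Subset (2 + k) → ℚ) λ h →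
    IsFracHomTiling a b c L h × (ℕtoℚ k ℚ.+ recip (a * b * c) ℚ.≤ weight L h) ×
    hminAtLeast L h (recip (b * c * c))

  record Augmentation (x* y* z* : Fin k) (δ : ℕ) : Set where
    field
      extra            : List (WeightedTriple (2 + k))
      extra⊆L          : All (λ t → vertices t ∈E L) extra
      u₀∈extra         : All (λ t → u₀ ∈ₛ vertices t) extra
      extra-injective  : ∀ {t t′} → t ∈ extra → t′ ∈ extra → vertices t ≡ vertices t′ → t ≡ t′
      extra-shaped     : All (SelfShaped a b c) extra
      extra-coarse     : All (CoarseTriple (b * c * c) M) extra
      extra-load-K     : ∀ i → ∑ extra (load (inK i)) ≤ δ * share i x* y* z*
      extra-load-u₀    : ∑ extra (load u₀) ≤ M
      extra-load-u₁    : ∑ extra (load u₁) ≤ M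
      gain             : δ * (a * k) + 2 * a ≤ ∑ extra total

  module Reduced {x* y* z* : Fin k} (x*∈A : x* ∈ partA) (y*∈B : y* ∈ partB) (z*∈C : z* ∈ partC)
                 (m* δ : ℕ) (m*+δ≡2 : m* + δ ≡ 2) where

    at* : ∀ x y z → Dec (x ≡ x* × y ≡ y* × z ≡ z*)
    at* x y z = x ≟ x* ×-dec y ≟ y* ×-dec z ≟ z*

    multiplicity : Fin k → Fin k → Fin k → ℕ
    multiplicity x y z = if does (at* x y z) then m* else 2

    reducedTriple : Fin k → Fin k → Fin k → WeightedTriple (2 + k)
    reducedTriple x y z = kTriple (multiplicity x y z) x y z

    reducedK : List (WeightedTriple (2 + k))
    reducedK = concatMap (λ x → concatMap (λ y → map (reducedTriple x y) partC) partB) partA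

    ∑-reducedK : ∀ (f : WeightedTriple (2 + k) → ℕ) → ∑ reducedK f ≡ ∑ᴷ (λ x y z → f (reducedTriple x y z))
    ∑-reducedK f = trans (∑-concatMap partA _ f) (∑-cong partA λ x →
                     trans (∑-concatMap partB _ f) (∑-cong partB λ y → ∑-map partC (reducedTriple x y) f))

    multiplicity-defect : ∀ x y z n → multiplicity x y z * n + δ * (n if at* x y z) ≡ 2 * n
    multiplicity-defect x y z = defect (at* x y z)
      where
      defect : ∀ {P : Set} (d : Dec P) n → (if does d then m* else 2) * n + δ * (n if d) ≡ 2 * n
      defect (yes _) n = trans (sym (ℕP.*-distribʳ-+ n m* δ)) (cong (_* n) m*+δ≡2)
      defect (no _)  n = trans (cong (2 * n +_) (ℕP.*-zeroʳ δ)) (ℕP.+-identityʳ (2 * n))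

    ∑ᴷ-at* : ∀ (F : Fin k → Fin k → Fin k → ℕ) → ∑ᴷ (λ x y z → F x y z if at* x y z) ≡ F x* y* z*
    ∑ᴷ-at* F = begin
      ∑ᴷ (λ x y z → F x y z if at* x y z)
        ≡⟨ ∑ᴷ-cong (λ x y z → if-×-dec (x ≟ x*) (y ≟ y*) (z ≟ z*) (F x y z)) ⟩
      ∑[ x ∈ partA ] ∑[ y ∈ partB ] ∑[ z ∈ partC ] (((F x y z if z ≟ z*) if y ≟ y*) if x ≟ x*)
        ≡⟨ ∑-cong partA (λ x → ∑-cong partB λ y →
             trans (∑-if partC (x ≟ x*) _) (cong (λ n → n if x ≟ x*) (∑-if partC (y ≟ y*) _))) ⟩
      ∑[ x ∈ partA ] ∑[ y ∈ partB ] ((∑[ z ∈ partC ] (F x y z if z ≟ z*) if y ≟ y*) if x ≟ x*)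
        ≡⟨ ∑-cong partA (λ x → ∑-cong partB λ y → cong (λ n → (n if y ≟ y*) if x ≟ x*)
             (∑-if-∈ _≟_ (F x y) (interval-unique (a + b) c ℕP.≤-refl) z*∈C)) ⟩
      ∑[ x ∈ partA ] ∑[ y ∈ partB ] ((F x y z* if y ≟ y*) if x ≟ x*)
        ≡⟨ ∑-cong partA (λ x → trans (∑-if partB (x ≟ x*) _) (cong (λ n → n if x ≟ x*)
             (∑-if-∈ _≟_ (λ y → F x y z*) (interval-unique a b B-fits) y*∈B))) ⟩
      ∑[ x ∈ partA ] (F x y* z* if x ≟ x*)
        ≡⟨ ∑-if-∈ _≟_ (λ x → F x y* z*) (interval-unique 0 a A-fits) x*∈A ⟩
      F x* y* z* ∎
      where open ≡-Reasoning

    ∑ᴷ-reduced : ∀ (F : Fin k → Fin k → Fin k → ℕ) →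
                 ∑ᴷ (λ x y z → multiplicity x y z * F x y z) + δ * F x* y* z* ≡ 2 * ∑ᴷ F
    ∑ᴷ-reduced F = begin
      ∑ᴷ (λ x y z → multiplicity x y z * F x y z) + δ * F x* y* z*
        ≡⟨ cong (λ n → ∑ᴷ (λ x y z → multiplicity x y z * F x y z) + δ * n) (∑ᴷ-at* F) ⟨
      ∑ᴷ (λ x y z → multiplicity x y z * F x y z) + δ * ∑ᴷ (λ x y z → F x y z if at* x y z)
        ≡⟨ cong (∑ᴷ (λ x y z → multiplicity x y z * F x y z) +_) (∑ᴷ-*ˡ δ (λ x y z → F x y z if at* x y z)) ⟨
      ∑ᴷ (λ x y z → multiplicity x y z * F x y z) + ∑ᴷ (λ x y z → δ * (F x y z if at* x y z))
        ≡⟨ ∑ᴷ-distrib-+ (λ x y z → multiplicity x y z * F x y z) (λ x y z → δ * (F x y z if at* x y z)) ⟨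
      ∑ᴷ (λ x y z → multiplicity x y z * F x y z + δ * (F x y z if at* x y z))
        ≡⟨ ∑ᴷ-cong (λ x y z → multiplicity-defect x y z (F x y z)) ⟩
      ∑ᴷ (λ x y z → 2 * F x y z)
        ≡⟨ ∑ᴷ-*ˡ 2 F ⟩
      2 * ∑ᴷ F ∎
      where open ≡-Reasoning

    reducedK-load-inK : ∀ i → ∑ reducedK (load (inK i)) + δ * share i x* y* z* ≡ M
    reducedK-load-inK i = begin
      ∑ reducedK (load (inK i)) + δ * share i x* y* z*
        ≡⟨ cong (_+ δ * share i x* y* z*)
             (trans (∑-reducedK (load (inK i)))
                    (∑ᴷ-cong λ x y z → load-kTriple (multiplicity x y z) i x y z)) ⟩
      ∑ᴷ (λ x y z → multiplicity x y z * share i x y z) + δ * share i x* y* z*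
        ≡⟨ ∑ᴷ-reduced (share i) ⟩
      2 * ∑ᴷ (share i)
        ≡⟨ cong (2 *_) (∑ᴷ-share i) ⟩
      M ∎
      where open ≡-Reasoning

    reducedK-total : ∑ reducedK total + δ * (a * k) ≡ M * k
    reducedK-total = begin
      ∑ reducedK total + δ * (a * k)
        ≡⟨ cong (_+ δ * (a * k))
                (trans (∑-reducedK total) (∑ᴷ-cong λ x y z → factor (multiplicity x y z) a b c)) ⟩
      ∑ᴷ (λ x y z → multiplicity x y z * (a * k)) + δ * (a * k)
        ≡⟨ ∑ᴷ-reduced (λ _ _ _ → a * k) ⟩
      2 * ∑ᴷ (λ _ _ _ → a * k)
        ≡⟨ cong (2 *_) (∑ᴷ-const (a * k)) ⟩
      2 * (a * (b * (c * (a * k))))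
        ≡⟨ regroup a b c k ⟩
      M * k ∎
      where
      open ≡-Reasoning
      factor : ∀ m a b c → m * a * a + m * a * b + m * a * c ≡ m * (a * (a + b + c))
      factor = solve-∀
      regroup : ∀ a b c k → 2 * (a * (b * (c * (a * k)))) ≡ 2 * (a * a * b * c) * k
      regroup = solve-∀

    ReducedTriple : WeightedTriple (2 + k) → Set
    ReducedTriple t = Σ (Fin k) λ x → Σ (Fin k) λ y → Σ (Fin k) λ z →
                      x ∈ partA × y ∈ partB × z ∈ partC × t ≡ reducedTriple x y z

    reducedK-triples : All ReducedTriple reducedK
    reducedK-triples = AllP.concat⁺ (AllP.map⁺ (All.tabulate λ {x} x∈A →
                         AllP.concat⁺ (AllP.map⁺ (All.tabulate λ {y} y∈B →
                           AllP.map⁺ (All.tabulate λ {z} z∈C → x , y , z , x∈A , y∈B , z∈C , refl)))))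

    reduced-vertices-injective : ∀ {t t′} → ReducedTriple t → ReducedTriple t′ →
                                 vertices t ≡ vertices t′ → t ≡ t′
    reduced-vertices-injective (x , y , z , x∈A , y∈B , z∈C , refl) (x′ , y′ , z′ , x′∈A , y′∈B , z′∈C , refl) same
      with kTriple-vertices-injective x∈A y∈B z∈C x′∈A y′∈B z′∈C same
    ... | refl , refl , refl = refl

    ∉reduced : ∀ {u t} → (∀ w → u ≢ inK w) → ReducedTriple t → u ∉ₛ vertices t
    ∉reduced u∉K (x , y , z , _ , _ , _ , refl) u∈ =
      [ u∉K x , [ u∉K y , u∉K z ]′ ]′ (∈triple⁻ (inK x) (inK y) (inK z) u∈)

    reducedK-load-outside : ∀ {u} → (∀ w → u ≢ inK w) → ∑ reducedK (load u) ≡ 0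
    reducedK-load-outside u∉K =
      trans (∑-congᴬ reducedK-triples λ {t} t-reduced → load-outside t (∉reduced u∉K t-reduced)) (∑-zero reducedK)

    module _ (aug : Augmentation x* y* z* δ) where
      open Augmentation aug

      D : List (WeightedTriple (2 + k))
      D = reducedK ++ extra

      D⊆L : All (λ t → vertices t ∈E L) D
      D⊆L = AllP.++⁺ (All.map (λ { (x , y , z , x∈A , y∈B , z∈C , refl) → kEdge∈L x∈A y∈B z∈C }) reducedK-triples)
                     extra⊆L

      D-injective : ∀ {t t′} → t ∈ D → t′ ∈ D → vertices t ≡ vertices t′ → t ≡ t′
      D-injective t∈D t′∈D same with ∈P.∈-++⁻ reducedK t∈D | ∈P.∈-++⁻ reducedK t′∈D
      ... | inj₁ t∈K | inj₁ t′∈K = reduced-vertices-injective (All.lookup reducedK-triples t∈K)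
                                                              (All.lookup reducedK-triples t′∈K) same
      ... | inj₁ t∈K | inj₂ t′∈X = ⊥-elim (∉reduced (λ _ ()) (All.lookup reducedK-triples t∈K)
                                             (subst (u₀ ∈ₛ_) (sym same) (All.lookup u₀∈extra t′∈X)))
      ... | inj₂ t∈X | inj₁ t′∈K = ⊥-elim (∉reduced (λ _ ()) (All.lookup reducedK-triples t′∈K)
                                             (subst (u₀ ∈ₛ_) same (All.lookup u₀∈extra t∈X)))

      ... | inj₂ t∈X | inj₂ t′∈X = extra-injective t∈X t′∈X same

      D-shaped : All (SelfShaped a b c) D
      D-shaped = AllP.++⁺ (All.map (λ { (x , y , z , x∈A , y∈B , z∈C , refl) →
                                        kTriple-self-shaped (multiplicity x y z) x∈A y∈B z∈C }) reducedK-triples)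
                          extra-shaped

      D-coarse : All (CoarseTriple (b * c * c) M) D
      D-coarse = AllP.++⁺ (All.map (λ { (x , y , z , _ , _ , _ , refl) → kTriple-coarse (multiplicity x y z) x y z })
                                   reducedK-triples)
                          extra-coarse

      D-capacity : ∀ v → ∑ D (load v) ≤ M
      D-capacity v rewrite ∑-++ reducedK extra (load v) = by-vertex v
        where
        by-vertex : ∀ v → ∑ reducedK (load v) + ∑ extra (load v) ≤ M
        by-vertex Fin.zero rewrite reducedK-load-outside {u₀} (λ _ ()) = extra-load-u₀
        by-vertex (Fin.suc Fin.zero) rewrite reducedK-load-outside {u₁} (λ _ ()) = extra-load-u₁
        by-vertex (Fin.suc (Fin.suc i)) = subst (∑ reducedK (load (inK i)) + ∑ extra (load (inK i)) ≤_)
          (reducedK-load-inK i) (ℕP.+-monoʳ-≤ (∑ reducedK (load (inK i))) (extra-load-K i))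

      D-total : M * k + 2 * a ≤ ∑ D total
      D-total = begin
        M * k + 2 * a                                   ≡⟨ cong (_+ 2 * a) reducedK-total ⟨
        ∑ reducedK total + δ * (a * k) + 2 * a          ≡⟨ ℕP.+-assoc (∑ reducedK total) _ _ ⟩
        ∑ reducedK total + (δ * (a * k) + 2 * a)        ≤⟨ ℕP.+-monoʳ-≤ (∑ reducedK total) gain ⟩
        ∑ reducedK total + ∑ extra total                ≡⟨ ∑-++ reducedK extra total ⟨
        ∑ D total                                       ∎
        where open ℕP.≤-Reasoning

      open FromWeightedTriples a b c L M D D⊆L D-injective D-shaped D-capacity

      weight-bound : ℕtoℚ k ℚ.+ recip (a * b * c) ℚ.≤ weight L h
      weight-bound = subst₂ ℚ._≤_ (sym (ℕtoℚ-+-recip k (a * b * c))) (sym weight-h) (/ₙ-≤ (begin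
        (k * (a * b * c) + 1) * M      ≡⟨ regroup a b c k ⟩
        (M * k + 2 * a) * (a * b * c)  ≤⟨ ℕP.*-monoˡ-≤ (a * b * c) D-total ⟩
        ∑ D total * (a * b * c)        ∎))
        where
        open ℕP.≤-Reasoning
        regroup : ∀ a b c k → (k * (a * b * c) + 1) * (2 * (a * a * b * c))
                              ≡ (2 * (a * a * b * c) * k + 2 * a) * (a * b * c)
        regroup = solve-∀

      augmented : TilingWithBounds
      augmented = h , tiling , weight-bound , hmin (b * c * c) D-coarse

  x₀ y₀ z₀ : Fin k
  x₀ = first 0 a A-fits 1≤a
  y₀ = first a b B-fits 1≤b
  z₀ = first (a + b) c ℕP.≤-refl 1≤c

  x₀∈A : x₀ ∈ partA
  x₀∈A = first∈interval 0 a A-fits 1≤a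

  y₀∈B : y₀ ∈ partB
  y₀∈B = first∈interval a b B-fits 1≤b

  z₀∈C : z₀ ∈ partC
  z₀∈C = first∈interval (a + b) c ℕP.≤-refl 1≤c

  uu′Triple : Fin k → ℕ → ℕ → ℕ → WeightedTriple (2 + k)
  uu′Triple w α β γ = ⟨ inK w , u₀ , u₁ ∣ α , β , γ ⟩

  uu′-edge∈L : ∀ {w : Fin k} → triple u₀ u₁ (inK w) ∈E L → triple (inK w) u₀ u₁ ∈E L
  uu′-edge∈L {w} = subst (_∈E L) (sym (triple-rotate (inK w) u₀ u₁))

  u₀∈uu′-edge : ∀ {w : Fin k} → u₀ ∈ₛ triple (inK w) u₀ u₁
  u₀∈uu′-edge {w} = y∈triple (inK w) u₀ u₁

  module _ (w : Fin k) (α β γ : ℕ) where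

    uu′Triple-self-shaped : Shaped a b c α β γ → SelfShaped a b c (uu′Triple w α β γ)
    uu′Triple-self-shaped αβγ-shaped
      rewrite load-p (uu′Triple w α β γ) (λ ()) (λ ()) | load-q (uu′Triple w α β γ) (λ ()) (λ ())
      = αβγ-shaped

    load-uu′Triple-K : ∀ i → load (inK i) (uu′Triple w α β γ) ≡ (α if w ≟ i)
    load-uu′Triple-K i = trans (ℕP.+-identityʳ _) (trans (ℕP.+-identityʳ _)
      (if-cong (inK i ≟ inK w) (w ≟ i) α (sym ∘ inK-injective) (cong inK ∘ sym)))

    load-uu′Triple-u₀ : load u₀ (uu′Triple w α β γ) ≡ β
    load-uu′Triple-u₀ = ℕP.+-identityʳ β

  third≤share : ∀ i x y z → (a * c if z ≟ i) ≤ share i x y z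
  third≤share i x y z = ℕP.m≤n+m _ ((a * a if x ≟ i) + (a * b if y ≟ i))

  second≤share : ∀ i x y z → (a * b if y ≟ i) ≤ share i x y z
  second≤share i x y z = ℕP.≤-trans (ℕP.m≤n+m _ (a * a if x ≟ i)) (ℕP.m≤m+n _ (a * c if z ≟ i))

  twice≤M : ∀ {w} → w ≤ a * a * b * c → 2 * w ≤ M
  twice≤M = ℕP.*-monoʳ-≤ 2

  bc≤a²bc : b * c ≤ a * a * b * c
  bc≤a²bc = begin
    b * c             ≡⟨ ℕP.*-identityˡ (b * c) ⟨
    1 * (b * c)       ≤⟨ ℕP.*-monoˡ-≤ (b * c) (ℕP.*-mono-≤ 1≤a 1≤a) ⟩
    a * a * (b * c)   ≡⟨ ℕP.*-assoc (a * a) b c ⟨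
    a * a * b * c     ∎
    where open ℕP.≤-Reasoning

  bb≤a²bc : b * b ≤ a * a * b * c
  bb≤a²bc = ℕP.≤-trans (ℕP.*-monoʳ-≤ b b≤c) bc≤a²bc

  single-uu′Triple : ∀ {x* y* z* δ} w α β γ → triple u₀ u₁ (inK w) ∈E L →
                     Shaped a b c α β γ → CoarseTriple (b * c * c) M (uu′Triple w α β γ) →
                     (∀ i → (α if w ≟ i) ≤ δ * share i x* y* z*) → β ≤ M → γ ≤ M →
                     δ * (a * k) + 2 * a ≤ α + β + γ → Augmentation x* y* z* δ
  single-uu′Triple {δ = δ} w α β γ wuu′∈L αβγ-shaped coarse α≤share β≤M γ≤M gain = record
    { extra           = t ∷ []
    ; extra⊆L         = uu′-edge∈L wuu′∈L ∷ []
    ; u₀∈extra        = u₀∈uu′-edge ∷ []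
    ; extra-injective = λ t₁∈ t₂∈ _ → ∈-singleton-injective t₁∈ t₂∈
    ; extra-shaped    = uu′Triple-self-shaped w α β γ αβγ-shaped ∷ []
    ; extra-coarse    = coarse ∷ []
    ; extra-load-K    = λ i → subst (_≤ _) (sym (trans (∑-singleton t (load (inK i))) (load-uu′Triple-K w α β γ i)))
                                    (α≤share i)
    ; extra-load-u₀   = subst (_≤ M) (sym (trans (∑-singleton t (load u₀)) (load-uu′Triple-u₀ w α β γ))) β≤M
    ; extra-load-u₁   = subst (_≤ M) (sym (∑-singleton t (load u₁))) γ≤M
    ; gain            = subst (δ * (a * k) + 2 * a ≤_) (sym (∑-singleton t total)) gain
    }
    where
    t : WeightedTriple (2 + k)
    t = uu′Triple w α β γ

  augment-C : ∀ {z} → triple u₀ u₁ (inK z) ∈E L → Augmentation x₀ y₀ z 2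
  augment-C {z} zuu′∈L =
    single-uu′Triple z τ τ τ zuu′∈L (Shaped-constant τ a≤b b≤c) (τ-coarse , τ-coarse , τ-coarse)
      (λ i → begin
        (2 * (a * c) if z ≟ i)  ≡⟨ if-*ˡ (z ≟ i) 2 (a * c) ⟩
        2 * (a * c if z ≟ i)    ≤⟨ ℕP.*-monoʳ-≤ 2 (third≤share i x₀ y₀ z) ⟩
        2 * share i x₀ y₀ z     ∎)
      τ≤M τ≤M
      (begin
        2 * (a * k) + 2 * a      ≡⟨ factor a b c ⟩
        2 * a * (suc a + b + c)  ≤⟨ ℕP.*-monoʳ-≤ (2 * a) (ℕP.+-monoˡ-≤ c (ℕP.+-mono-≤ a<c b≤c)) ⟩
        2 * a * (c + c + c)      ≡⟨ expand a c ⟩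
        τ + τ + τ                ∎)
    where
    open ℕP.≤-Reasoning
    τ : ℕ
    τ = 2 * (a * c)
    τ-coarse : Coarse (b * c * c) M τ
    τ-coarse = Coarse-≥a² (ℕP.≤-trans (ℕP.*-monoʳ-≤ a a≤c) (ℕP.m≤m+n (a * c) _))
    τ≤M : τ ≤ M
    τ≤M = twice≤M (ℕP.≤-trans (ℕP.*-monoˡ-≤ c a≤b) bc≤a²bc)
    factor : ∀ a b c → 2 * (a * (a + b + c)) + 2 * a ≡ 2 * a * (suc a + b + c)
    factor = solve-∀
    expand : ∀ a c → 2 * a * (c + c + c) ≡ 2 * (a * c) + 2 * (a * c) + 2 * (a * c)
    expand = solve-∀

  augment-B : ∀ {y} → a < b → triple u₀ u₁ (inK y) ∈E L → Augmentation x₀ y z₀ 2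
  augment-B {y} a<b yuu′∈L =
    single-uu′Triple y (2 * b * a) (2 * b * b) (2 * b * c) yuu′∈L (Shaped-scaled (2 * b) a≤b b≤c)
      (Coarse-≥a² (ℕP.*-monoˡ-≤ a a≤2b) , Coarse-≥a² (ℕP.*-mono-≤ a≤2b a≤b) , Coarse-≥a² (ℕP.*-mono-≤ a≤2b a≤c))
      (λ i → begin
        (2 * b * a if y ≟ i)    ≡⟨ cong (λ w → w if y ≟ i) (swap a b) ⟩
        (2 * (a * b) if y ≟ i)  ≡⟨ if-*ˡ (y ≟ i) 2 (a * b) ⟩
        2 * (a * b if y ≟ i)    ≤⟨ ℕP.*-monoʳ-≤ 2 (second≤share i x₀ y z₀) ⟩
        2 * share i x₀ y z₀     ∎)
      (subst (_≤ M) (sym (ℕP.*-assoc 2 b b)) (twice≤M bb≤a²bc))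
      (subst (_≤ M) (sym (ℕP.*-assoc 2 b c)) (twice≤M bc≤a²bc))
      (begin
        2 * (a * k) + 2 * a      ≡⟨ ℕP.*-distribˡ-+ 2 (a * k) a ⟨
        2 * (a * k + a)          ≤⟨ ℕP.*-monoʳ-≤ 2 (ℕP.+-monoʳ-≤ (a * k) A-fits) ⟩
        2 * (a * k + k)          ≡⟨ cong (2 *_) (ℕP.+-comm (a * k) k) ⟩
        2 * (suc a * k)          ≤⟨ ℕP.*-monoʳ-≤ 2 (ℕP.*-monoˡ-≤ k a<b) ⟩
        2 * (b * k)              ≡⟨ expand b a c ⟩
        2 * b * a + 2 * b * b + 2 * b * c ∎)
    where
    open ℕP.≤-Reasoning
    a≤2b : a ≤ 2 * b
    a≤2b = ℕP.≤-trans a≤b (ℕP.m≤m+n b (b + 0))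
    swap : ∀ a b → 2 * b * a ≡ 2 * (a * b)
    swap = solve-∀
    expand : ∀ b a c → 2 * (b * (a + b + c)) ≡ 2 * b * a + 2 * b * b + 2 * b * c
    expand = solve-∀

  uu′-edge-injective : ∀ {x y : Fin k} → triple (inK x) u₀ u₁ ≡ triple (inK y) u₀ u₁ → x ≡ y
  uu′-edge-injective {x} {y} same with ∈triple⁻ (inK y) u₀ u₁ (subst (inK x ∈ₛ_) same (x∈triple (inK x) u₀ u₁))
  ... | inj₁ x≡y       = inK-injective x≡y
  ... | inj₂ (inj₁ ())
  ... | inj₂ (inj₂ ())

  augment-AB : ∀ {x y} → b ≤ a → x ∈ partA → y ∈ partB →
               triple u₀ u₁ (inK x) ∈E L → triple u₀ u₁ (inK y) ∈E L → Augmentation x y z₀ 1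
  augment-AB {x} {y} b≤a x∈A y∈B xuu′∈L yuu′∈L = record
    { extra           = tx ∷ ty ∷ []
    ; extra⊆L         = uu′-edge∈L xuu′∈L ∷ uu′-edge∈L yuu′∈L ∷ []
    ; u₀∈extra        = u₀∈uu′-edge ∷ u₀∈uu′-edge ∷ []
    ; extra-injective = injective
    ; extra-shaped    = uu′Triple-self-shaped x (b * a) (b * b) (b * c) (Shaped-scaled b a≤b b≤c) ∷
                        uu′Triple-self-shaped y (b * a) (b * b) (b * c) (Shaped-scaled b a≤b b≤c) ∷ []
    ; extra-coarse    = coarse ∷ coarse ∷ []
    ; extra-load-K    = λ i → begin
        load (inK i) tx + (load (inK i) ty + 0)
          ≡⟨ cong₂ _+_ (load-uu′Triple-K x (b * a) (b * b) (b * c) i)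
                       (trans (ℕP.+-identityʳ _) (load-uu′Triple-K y (b * a) (b * b) (b * c) i)) ⟩
        (b * a if x ≟ i) + (b * a if y ≟ i)
          ≤⟨ ℕP.+-mono-≤ (if-mono-≤ (x ≟ i) (ℕP.*-monoˡ-≤ a b≤a))
                         (if-mono-≤ (y ≟ i) (ℕP.≤-reflexive (ℕP.*-comm b a))) ⟩
        (a * a if x ≟ i) + (a * b if y ≟ i)
          ≤⟨ ℕP.m≤m+n _ (a * c if z₀ ≟ i) ⟩
        share i x y z₀
          ≡⟨ ℕP.*-identityˡ (share i x y z₀) ⟨
        1 * share i x y z₀ ∎
    ; extra-load-u₀   = subst (_≤ M) (sym (cong₂ (λ β β′ → β + (β′ + 0)) (load-uu′Triple-u₀ x (b * a) (b * b) (b * c))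
                                                                      (load-uu′Triple-u₀ y (b * a) (b * b) (b * c))))
                              (twice≤M bb≤a²bc)
    ; extra-load-u₁   = twice≤M bc≤a²bc
    ; gain            = begin
        1 * (a * k) + 2 * a        ≡⟨ regroup a k ⟩
        a * k + a * 2              ≤⟨ ℕP.+-monoʳ-≤ (a * k) (ℕP.*-monoʳ-≤ a 2≤k) ⟩
        a * k + a * k              ≤⟨ ℕP.+-mono-≤ (ℕP.*-monoˡ-≤ k a≤b) (ℕP.*-monoˡ-≤ k a≤b) ⟩
        b * k + b * k              ≡⟨ expand b a c ⟩
        total tx + (total ty + 0)  ∎
    }
    where
    open ℕP.≤-Reasoning
    tx ty : WeightedTriple (2 + k)
    tx = uu′Triple x (b * a) (b * b) (b * c)
    ty = uu′Triple y (b * a) (b * b) (b * c)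
    injective : ∀ {t t′} → t ∈ tx ∷ ty ∷ [] → t′ ∈ tx ∷ ty ∷ [] → vertices t ≡ vertices t′ → t ≡ t′
    injective (here refl)         (here refl)         _    = refl
    injective (here refl)         (there (here refl)) same = ⊥-elim (A≢B x∈A y∈B (uu′-edge-injective same))
    injective (there (here refl)) (here refl)         same = ⊥-elim (A≢B x∈A y∈B (uu′-edge-injective (sym same)))
    injective (there (here refl)) (there (here refl)) _    = refl
    coarse : CoarseTriple (b * c * c) M tx
    coarse = Coarse-≥a² (ℕP.*-monoˡ-≤ a a≤b) , Coarse-≥a² (ℕP.*-mono-≤ a≤b a≤b) , Coarse-≥a² (ℕP.*-mono-≤ a≤b a≤c)
    2≤k : 2 ≤ k
    2≤k = ℕP.≤-trans (ℕP.+-mono-≤ 1≤a 1≤b) (ℕP.m≤m+n (a + b) c)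
    regroup : ∀ a k → 1 * (a * k) + 2 * a ≡ a * k + a * 2
    regroup = solve-∀
    expand : ∀ b a c → b * (a + b + c) + b * (a + b + c) ≡ b * a + b * b + b * c + (b * a + b * b + b * c + 0)
    expand = solve-∀

  data Configuration (S : Subset k) : Set where
    meets-C  : ∀ {z} → z ∈ₛ S → z ∈ partC → Configuration S
    meets-B  : ∀ {y} → y ∈ₛ S → y ∈ partB → a < b → Configuration S
    meets-AB : ∀ {x y} → x ∈ₛ S → x ∈ partA → y ∈ₛ S → y ∈ partB → b ≤ a → Configuration S

  configuration-meeting-B : ∀ S → a < ∣ S ∣ → (∀ v → v ∈ₛ S → toℕ v < a + b) →
                            ∀ {y} → y ∈ₛ S → y ∈ partB → Configuration S
  configuration-meeting-B S a<∣S∣ S⊆AB y∈S y∈B with a ℕP.<? b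
  ... | yes a<b = meets-B y∈S y∈B a<b
  ... | no a≮b with FinP.any? (λ v → v SubsetP.∈? S ×-dec toℕ v ℕP.<? a)
  ...   | yes (x , x∈S , x<a) = meets-AB x∈S (∈-interval⁺ 0 a A-fits ℕ.z≤n x<a) y∈S y∈B (ℕP.≮⇒≥ a≮b)
  ...   | no S∌A = ⊥-elim (ℕP.<⇒≱ a<∣S∣ (subst (∣ S ∣ ≤_) (ℕP.≤-antisym (ℕP.≮⇒≥ a≮b) a≤b)
                     (∣p∣≤width S a b λ v v∈S → ℕP.≮⇒≥ (λ v<a → S∌A (v , v∈S , v<a)) , S⊆AB v v∈S)))

  configuration : ∀ S → a < ∣ S ∣ → Configuration S
  configuration S a<∣S∣ with FinP.any? (λ v → v SubsetP.∈? S ×-dec a + b ℕP.≤? toℕ v)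
  ... | yes (z , z∈S , a+b≤z) = meets-C z∈S (∈-interval⁺ (a + b) c ℕP.≤-refl a+b≤z (FinP.toℕ<n z))
  ... | no S∌C with FinP.any? (λ v → v SubsetP.∈? S ×-dec a ℕP.≤? toℕ v)
  ...   | yes (y , y∈S , a≤y) = configuration-meeting-B S a<∣S∣ S⊆AB y∈S (∈-interval⁺ a b B-fits a≤y (S⊆AB y y∈S))
    where
    S⊆AB : ∀ v → v ∈ₛ S → toℕ v < a + b
    S⊆AB v v∈S = ℕP.≰⇒> λ a+b≤v → S∌C (v , v∈S , a+b≤v)
  ...   | no S∌BC = ⊥-elim (ℕP.<⇒≱ a<∣S∣ (∣p∣≤width S 0 a λ v v∈S →
                      ℕ.z≤n , ℕP.≰⇒> λ a≤v → S∌BC (v , v∈S , a≤v)))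

  tiling : manyUU' a b c L → TilingWithBounds
  tiling (S , a<∣S∣ , S⊆uu′) with configuration S a<∣S∣
  ... | meets-C z∈S z∈C =
    Reduced.augmented x₀∈A y₀∈B z∈C 0 2 refl (augment-C (S⊆uu′ _ z∈S))
  ... | meets-B y∈S y∈B a<b =
    Reduced.augmented x₀∈A y∈B z₀∈C 0 2 refl (augment-B a<b (S⊆uu′ _ y∈S))
  ... | meets-AB x∈S x∈A y∈S y∈B b≤a =
    Reduced.augmented x∈A y∈B z₀∈C 1 1 refl (augment-AB b≤a x∈A y∈B (S⊆uu′ _ x∈S) (S⊆uu′ _ y∈S))

proposition4p6 : (a b c : ℕ) → 1 ≤ a → a ≤ b → b ≤ c → a < c →
    (L : ThreeGraph (2 + (a + b + c))) →
    containsK a b c L → manyUU' a b c L →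
    Σ (Fin (2 + (a + b + c)) → Subset (2 + (a + b + c)) → ℚ) λ h →
      IsFracHomTiling a b c L h ×
      (ℕtoℚ (a + b + c) ℚ.+ recip (a * b * c) ℚ.≤ weight L h) ×
      hminAtLeast L h (recip (b * c * c))
proposition4p6 a b c 1≤a a≤b b≤c a<c L K⊆L = Construction.tiling a b c 1≤a a≤b b≤c a<c L K⊆L
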